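{- Let $p>3$ be a prime. Then $$\sum_{k=0}^{p-1}k\sum_{1\le i<j\le k}\frac{1}{i^2j^2}\equiv -\frac12 B_{p-3}\pmod p.$$
   Context: $B_n$ denotes the $n$-th Bernoulli number. Congruences between rational numbers are understood in the ring of rationals whose denominators are prime to $p$. -}

module Defs where

open import Data.Nat as ℕ using (ℕ; zero; suc)
open import Data.Bool using (if_then_else_)
open import Data.Nat.Combinatorics using (_C_)
open import Data.Integer as ℤ using (ℤ; +_)
open import Data.Integer.Divisibility using () renaming (_∣_ to _∣ℤ_)
open import Data.Rational using (ℚ; 0ℚ; 1ℚ; _+_; _*_; _-_; -_; _/_; ↥_)

sumℚ : ℕ → (ℕ → ℚ) → ℚ
sumℚ zero    f = 0ℚ
sumℚ (suc n) f = sumℚ n f + f n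

fromℕ : ℕ → ℚ
fromℕ n = (+ n) / 1

-- Bernoulli numbers (convention B₁ = -1/2), defined by B₀ = 1 and
-- Σ_{k=0}^{m} C(m+1,k) B_k = 0 for m ≥ 1, i.e.
-- B_m = -(1/(m+1)) Σ_{k<m} C(m+1,k) B_k.
private
  -- bern-upto m k = B_k  for k ≤ m (computed as a function table)
  table : ℕ → (ℕ → ℚ)
  table zero    k = 1ℚ
  table (suc m) k = if k ℕ.≤ᵇ m then table m k
    else - (((+ 1) / (suc (suc m))) * sumℚ (suc m) (λ i → fromℕ (suc (suc m) C i) * table m i))

bernoulli : ℕ → ℚ
bernoulli m = table m m

-- Congruence of rationals modulo p in ℤ_(p): p divides the (reduced)
-- numerator of a - b (equivalently a - b ∈ p ℤ_(p)).
_≡_[modℚ_] : ℚ → ℚ → ℕ → Set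
a ≡ b [modℚ p ] = (+ p) ∣ℤ (↥ (a - b))

invSq2 : ℕ → ℕ → ℚ
invSq2 i j = (+ 1) / (suc i ℕ.* suc i ℕ.* suc j ℕ.* suc j)

-- Σ_{1 ≤ i < j ≤ k} 1/(i² j²)
-- (j runs over 1..k as suc j', i over 1..j-1 as suc i' with i' < j')
innerSum : ℕ → ℚ
innerSum k = sumℚ k (λ j′ → sumℚ j′ (λ i′ → invSq2 i′ j′))

lhs : ℕ → ℚ
lhs p = sumℚ p (λ k → fromℕ k * innerSum k)

-- Summing over k first, the left-hand side becomes Σ_{j<p-1} w_j Σ_{i<j} 1/((i+1)²(j+1)²) with
-- w_j = Σ_{j<k<p} k ≡ -j(j+1)/2 (mod p), and j(j+1)/(j+1)² = 1 - 1/(j+1). By Fermat, 1/a ≡ a^(p-2)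
-- and 1/a² ≡ a^(p-3), which leaves -½ Σ_{J<p} (T(J) - T(J) J^(p-2)) with T(J) = Σ_{i<J} i^(p-3).
-- Faulhaber's formula expresses T(J) through Bernoulli numbers, and the power sums Σ_{J<p} J^e
-- vanish mod p unless e > 0 and p - 1 ∣ e, in which case they are -1. Only B_{p-3} survives.
module Submission where

open import Defs
open import Data.Nat using (ℕ; _<_; _∸_)
open import Data.Nat.Primality using (Prime)
open import Data.Integer using (+_; -[1+_])
open import Data.Rational using (_*_; _/_)

open import Algebra.Bundles using (CommutativeRing)
open import Data.Bool.Base using (true; if_then_else_)
open import Data.Bool.Properties using (if-cong; T-≡; ¬-not)
open import Data.Empty using (⊥-elim)
open import Data.Integer as ℤ using (ℤ)
import Data.Integer.Properties as ℤₚ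
import Data.Integer.Tactic.RingSolver as ℤ-Solver
open import Data.Maybe.Base using (Maybe; just; nothing)
open import Data.Nat as ℕ using (zero; suc; NonZero; _≤_; z≤n; s≤s; _!; nonTrivial⇒n>1)
open import Data.Nat.Combinatorics
  using (_C_; nCn≡1; nC1≡n; k>n⇒nCk≡0; nCk≡nC[n∸k]; nCk+nC[k+1]≡[n+1]C[k+1]; nCk≡n!/k![n-k]!; k![n∸k]!∣n!)
open import Data.Nat.Divisibility using (_∣_; _∤_; divides; ∣-refl; ∣m⇒∣m*n; ∣⇒≤; ∣1⇒≡1)
open import Data.Nat.DivMod using (m/n*n≡m)
open import Data.Nat.Primality using (euclidsLemma; ¬prime[1]; prime⇒nonTrivial)
import Data.Nat.Properties as ℕₚ
import Data.Nat.Tactic.RingSolver as ℕ-Solver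
open import Data.Rational using (ℚ; mkℚ; 0ℚ; 1ℚ; _+_; _-_; -_; ↥_; ↧_; toℚᵘ)
open import Data.Rational.Properties as ℚ using (toℚᵘ-injective; toℚᵘ-fromℚᵘ)
import Data.Rational.Unnormalised as ℚᵘ
import Data.Rational.Unnormalised.Properties as ℚᵘ
open import Data.Sum using (inj₁; inj₂; [_,_])
open import Function.Base using (id)
open import Function.Bundles using (Equivalence)
open import Level using (0ℓ)
open import Relation.Binary.Bundles using (Setoid)
import Relation.Binary.Reasoning.Setoid as SetoidReasoning
open import Relation.Binary.PropositionalEquality
open import Relation.Nullary using (yes; no)
open import Tactic.RingSolver using (solve-∀)
open import Tactic.RingSolver.Core.AlmostCommutativeRing using (AlmostCommutativeRing; fromCommutativeRing)

open import Algebra.Definitions.RawSemiring ℚ.+-*-rawSemiring using (_^_)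
open import Algebra.Properties.Semiring.Exp (CommutativeRing.semiring ℚ.+-*-commutativeRing) using (^-homo-*)

ℚ-ring : AlmostCommutativeRing 0ℓ 0ℓ
ℚ-ring = fromCommutativeRing ℚ.+-*-commutativeRing isZero
  where
  isZero : (x : ℚ) → Maybe (0ℚ ≡ x)
  isZero x with x ℚ.≟ 0ℚ
  ... | yes x≡0 = just (sym x≡0)
  ... | no _    = nothing

fromℤ : ℤ → ℚ
fromℤ i = i / 1

toℚᵘ-fromℤ : ∀ i → toℚᵘ (fromℤ i) ℚᵘ.≃ ℚᵘ.mkℚᵘ i 0
toℚᵘ-fromℤ i = toℚᵘ-fromℚᵘ (ℚᵘ.mkℚᵘ i 0)

fromℤ-+ : ∀ i j → fromℤ (i ℤ.+ j) ≡ fromℤ i + fromℤ j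
fromℤ-+ i j = toℚᵘ-injective (begin
  toℚᵘ (fromℤ (i ℤ.+ j))               ≈⟨ toℚᵘ-fromℤ (i ℤ.+ j) ⟩
  ℚᵘ.mkℚᵘ (i ℤ.+ j) 0                  ≈⟨ ℚᵘ.*≡* (eq i j) ⟩
  ℚᵘ.mkℚᵘ i 0 ℚᵘ.+ ℚᵘ.mkℚᵘ j 0          ≈⟨ ℚᵘ.+-cong (toℚᵘ-fromℤ i) (toℚᵘ-fromℤ j) ⟨
  toℚᵘ (fromℤ i) ℚᵘ.+ toℚᵘ (fromℤ j)   ≈⟨ ℚ.toℚᵘ-homo-+ (fromℤ i) (fromℤ j) ⟨
  toℚᵘ (fromℤ i + fromℤ j)             ∎)
  where
  open ℚᵘ.≃-Reasoning
  eq : ∀ i j → (i ℤ.+ j) ℤ.* + 1 ≡ (i ℤ.* + 1 ℤ.+ j ℤ.* + 1) ℤ.* + 1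
  eq = ℤ-Solver.solve-∀

fromℤ-* : ∀ i j → fromℤ (i ℤ.* j) ≡ fromℤ i * fromℤ j
fromℤ-* i j = toℚᵘ-injective (begin
  toℚᵘ (fromℤ (i ℤ.* j))               ≈⟨ toℚᵘ-fromℤ (i ℤ.* j) ⟩
  ℚᵘ.mkℚᵘ i 0 ℚᵘ.* ℚᵘ.mkℚᵘ j 0          ≈⟨ ℚᵘ.*-cong (toℚᵘ-fromℤ i) (toℚᵘ-fromℤ j) ⟨
  toℚᵘ (fromℤ i) ℚᵘ.* toℚᵘ (fromℤ j)   ≈⟨ ℚ.toℚᵘ-homo-* (fromℤ i) (fromℤ j) ⟨
  toℚᵘ (fromℤ i * fromℤ j)             ∎)
  where open ℚᵘ.≃-Reasoning

fromℤ-neg : ∀ i → fromℤ (ℤ.- i) ≡ - fromℤ i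
fromℤ-neg i = toℚᵘ-injective (begin
  toℚᵘ (fromℤ (ℤ.- i))       ≈⟨ toℚᵘ-fromℤ (ℤ.- i) ⟩
  ℚᵘ.- ℚᵘ.mkℚᵘ i 0           ≈⟨ ℚᵘ.-‿cong (toℚᵘ-fromℤ i) ⟨
  ℚᵘ.- toℚᵘ (fromℤ i)        ≈⟨ ℚ.toℚᵘ-homo‿- (fromℤ i) ⟨
  toℚᵘ (- fromℤ i)           ∎)
  where open ℚᵘ.≃-Reasoning

↥*≡*↧ : ∀ q b c → q * fromℕ b ≡ fromℤ c → ↥ q ℤ.* + b ≡ c ℤ.* ↧ q
↥*≡*↧ q@(mkℚ n d _) b c q*b≡c = begin
  n ℤ.* + b                         ≡⟨ ℤₚ.*-identityʳ _ ⟨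
  n ℤ.* + b ℤ.* + 1                 ≡⟨ ℚᵘ.drop-*≡* toℚᵘ[q*b]≃c ⟩
  c ℤ.* + suc (d ℕ.* 1)             ≡⟨ cong (λ e → c ℤ.* + suc e) (ℕₚ.*-identityʳ d) ⟩
  c ℤ.* + suc d                     ∎
  where
  open ≡-Reasoning
  toℚᵘ[q*b]≃c : toℚᵘ q ℚᵘ.* ℚᵘ.mkℚᵘ (+ b) 0 ℚᵘ.≃ ℚᵘ.mkℚᵘ c 0
  toℚᵘ[q*b]≃c = ℚᵘ.≃-trans (ℚᵘ.*-congˡ {toℚᵘ q} (ℚᵘ.≃-sym (toℚᵘ-fromℤ (+ b))))
    (ℚᵘ.≃-trans (ℚᵘ.≃-sym (ℚ.toℚᵘ-homo-* q (fromℕ b)))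
      (ℚᵘ.≃-trans (ℚ.toℚᵘ-cong q*b≡c) (toℚᵘ-fromℤ c)))

fromℕ-+ : ∀ m n → fromℕ (m ℕ.+ n) ≡ fromℕ m + fromℕ n
fromℕ-+ m n = fromℤ-+ (+ m) (+ n)

fromℕ-* : ∀ m n → fromℕ (m ℕ.* n) ≡ fromℕ m * fromℕ n
fromℕ-* m n = trans (cong fromℤ (ℤₚ.pos-* m n)) (fromℤ-* (+ m) (+ n))

fromℕ-suc : ∀ n → fromℕ (suc n) ≡ 1ℚ + fromℕ n
fromℕ-suc = fromℕ-+ 1

fromℕ-2+ : ∀ n → fromℕ (suc (suc n)) ≡ 1ℚ + (1ℚ + fromℕ n)
fromℕ-2+ n = trans (fromℕ-suc (suc n)) (cong (λ a → 1ℚ + a) (fromℕ-suc n))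

1/suc : ℕ → ℚ
1/suc n = (+ 1) / suc n

toℚᵘ-1/suc : ∀ n → toℚᵘ (1/suc n) ℚᵘ.≃ ℚᵘ.mkℚᵘ (+ 1) n
toℚᵘ-1/suc n = toℚᵘ-fromℚᵘ (ℚᵘ.mkℚᵘ (+ 1) n)

1/suc-inverseˡ : ∀ n → 1/suc n * fromℕ (suc n) ≡ 1ℚ
1/suc-inverseˡ n = toℚᵘ-injective (begin
  toℚᵘ (1/suc n * fromℕ (suc n))                   ≈⟨ ℚ.toℚᵘ-homo-* (1/suc n) (fromℕ (suc n)) ⟩
  toℚᵘ (1/suc n) ℚᵘ.* toℚᵘ (fromℕ (suc n))         ≈⟨ ℚᵘ.*-cong (toℚᵘ-1/suc n) (toℚᵘ-fromℤ (+ suc n)) ⟩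
  ℚᵘ.1/ ℚᵘ.mkℚᵘ (+ suc n) 0 ℚᵘ.* ℚᵘ.mkℚᵘ (+ suc n) 0 ≈⟨ ℚᵘ.*-inverseˡ (ℚᵘ.mkℚᵘ (+ suc n) 0) ⟩
  ℚᵘ.1ℚᵘ                                          ∎)
  where open ℚᵘ.≃-Reasoning

1/suc-* : ∀ a b → (+ 1) / (suc a ℕ.* suc b) ≡ 1/suc a * 1/suc b
1/suc-* a b = toℚᵘ-injective (begin
  toℚᵘ ((+ 1) / (suc a ℕ.* suc b))         ≈⟨ toℚᵘ-fromℚᵘ _ ⟩
  ℚᵘ.mkℚᵘ (+ 1) a ℚᵘ.* ℚᵘ.mkℚᵘ (+ 1) b     ≈⟨ ℚᵘ.*-cong (toℚᵘ-1/suc a) (toℚᵘ-1/suc b) ⟨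
  toℚᵘ (1/suc a) ℚᵘ.* toℚᵘ (1/suc b)      ≈⟨ ℚ.toℚᵘ-homo-* (1/suc a) (1/suc b) ⟨
  toℚᵘ (1/suc a * 1/suc b)                ∎)
  where open ℚᵘ.≃-Reasoning

-- Finite sums

sum-cong : ∀ n {f g : ℕ → ℚ} → (∀ i → i < n → f i ≡ g i) → sumℚ n f ≡ sumℚ n g
sum-cong zero    f≡g = refl
sum-cong (suc n) f≡g = cong₂ _+_ (sum-cong n (λ i i<n → f≡g i (ℕₚ.m<n⇒m<1+n i<n))) (f≡g n (ℕₚ.n<1+n n))

sum-zero : ∀ n → sumℚ n (λ _ → 0ℚ) ≡ 0ℚ
sum-zero zero    = refl
sum-zero (suc n) = cong (_+ 0ℚ) (sum-zero n)

sum-one : ∀ n → sumℚ n (λ _ → 1ℚ) ≡ fromℕ n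
sum-one zero    = refl
sum-one (suc n) = begin
  sumℚ n (λ _ → 1ℚ) + 1ℚ   ≡⟨ cong (_+ 1ℚ) (sum-one n) ⟩
  fromℕ n + 1ℚ             ≡⟨ ℚ.+-comm (fromℕ n) 1ℚ ⟩
  1ℚ + fromℕ n             ≡⟨ fromℕ-suc n ⟨
  fromℕ (suc n)            ∎
  where open ≡-Reasoning

sum-+ : ∀ n (f g : ℕ → ℚ) → sumℚ n (λ i → f i + g i) ≡ sumℚ n f + sumℚ n g
sum-+ zero    f g = refl
sum-+ (suc n) f g = begin
  sumℚ n (λ i → f i + g i) + (f n + g n)   ≡⟨ cong (_+ (f n + g n)) (sum-+ n f g) ⟩
  sumℚ n f + sumℚ n g + (f n + g n)        ≡⟨ medial (sumℚ n f) (sumℚ n g) (f n) (g n) ⟩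
  sumℚ n f + f n + (sumℚ n g + g n)        ∎
  where
  open ≡-Reasoning
  medial : ∀ a b c d → a + b + (c + d) ≡ a + c + (b + d)
  medial = solve-∀ ℚ-ring

*-distribˡ-sum : ∀ n c (f : ℕ → ℚ) → c * sumℚ n f ≡ sumℚ n (λ i → c * f i)
*-distribˡ-sum zero    c f = ℚ.*-zeroʳ c
*-distribˡ-sum (suc n) c f = begin
  c * (sumℚ n f + f n)          ≡⟨ ℚ.*-distribˡ-+ c (sumℚ n f) (f n) ⟩
  c * sumℚ n f + c * f n        ≡⟨ cong (_+ c * f n) (*-distribˡ-sum n c f) ⟩
  sumℚ n (λ i → c * f i) + c * f n ∎
  where open ≡-Reasoning

*-distribʳ-sum : ∀ n c (f : ℕ → ℚ) → sumℚ n f * c ≡ sumℚ n (λ i → f i * c)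
*-distribʳ-sum n c f = begin
  sumℚ n f * c              ≡⟨ ℚ.*-comm (sumℚ n f) c ⟩
  c * sumℚ n f              ≡⟨ *-distribˡ-sum n c f ⟩
  sumℚ n (λ i → c * f i)    ≡⟨ sum-cong n (λ i _ → ℚ.*-comm c (f i)) ⟩
  sumℚ n (λ i → f i * c)    ∎
  where open ≡-Reasoning

sum-- : ∀ n (f g : ℕ → ℚ) → sumℚ n (λ i → f i - g i) ≡ sumℚ n f - sumℚ n g
sum-- n f g = begin
  sumℚ n (λ i → f i - g i)                   ≡⟨ sum-cong n (λ i _ → minus (f i) (g i)) ⟩
  sumℚ n (λ i → f i + - 1ℚ * g i)            ≡⟨ sum-+ n f (λ i → - 1ℚ * g i) ⟩
  sumℚ n f + sumℚ n (λ i → - 1ℚ * g i)       ≡⟨ cong (λ s → sumℚ n f + s) (*-distribˡ-sum n (- 1ℚ) g) ⟨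
  sumℚ n f + - 1ℚ * sumℚ n g                 ≡⟨ minus (sumℚ n f) (sumℚ n g) ⟨
  sumℚ n f - sumℚ n g                        ∎
  where
  open ≡-Reasoning
  minus : ∀ x y → x - y ≡ x + - 1ℚ * y
  minus = solve-∀ ℚ-ring

sum-head : ∀ n (f : ℕ → ℚ) → sumℚ (suc n) f ≡ f 0 + sumℚ n (λ i → f (suc i))
sum-head zero    f = trans (ℚ.+-identityˡ (f 0)) (sym (ℚ.+-identityʳ (f 0)))
sum-head (suc n) f = begin
  sumℚ (suc n) f + f (suc n)                            ≡⟨ cong (_+ f (suc n)) (sum-head n f) ⟩
  f 0 + sumℚ n (λ i → f (suc i)) + f (suc n)            ≡⟨ ℚ.+-assoc (f 0) _ (f (suc n)) ⟩
  f 0 + (sumℚ n (λ i → f (suc i)) + f (suc n))          ∎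
  where open ≡-Reasoning

sum-comm : ∀ m n (f : ℕ → ℕ → ℚ) →
           sumℚ m (λ i → sumℚ n (λ j → f i j)) ≡ sumℚ n (λ j → sumℚ m (λ i → f i j))
sum-comm zero    n f = sym (sum-zero n)
sum-comm (suc m) n f = begin
  sumℚ m (λ i → sumℚ n (f i)) + sumℚ n (f m)           ≡⟨ cong (_+ sumℚ n (f m)) (sum-comm m n f) ⟩
  sumℚ n (λ j → sumℚ m (λ i → f i j)) + sumℚ n (f m)   ≡⟨ sum-+ n (λ j → sumℚ m (λ i → f i j)) (f m) ⟨
  sumℚ n (λ j → sumℚ (suc m) (λ i → f i j))            ∎
  where open ≡-Reasoning

sum-reverse : ∀ n (f : ℕ → ℚ) → sumℚ (suc n) f ≡ sumℚ (suc n) (λ k → f (n ∸ k))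
sum-reverse zero    f = refl
sum-reverse (suc n) f = begin
  sumℚ (suc (suc n)) f                                     ≡⟨ sum-head (suc n) f ⟩
  f 0 + sumℚ (suc n) (λ i → f (suc i))                     ≡⟨ cong (λ s → f 0 + s) (sum-reverse n (λ i → f (suc i))) ⟩
  f 0 + sumℚ (suc n) (λ k → f (suc (n ∸ k)))               ≡⟨ ℚ.+-comm (f 0) _ ⟩
  sumℚ (suc n) (λ k → f (suc (n ∸ k))) + f 0               ≡⟨ cong₂ _+_ (sum-cong (suc n) λ k k≤n →
                                                                 cong f (sym (ℕₚ.+-∸-assoc 1 (ℕₚ.≤-pred k≤n))))
                                                               (cong f (sym (ℕₚ.n∸n≡0 n))) ⟩
  sumℚ (suc (suc n)) (λ k → f (suc n ∸ k))                 ∎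
  where open ≡-Reasoning

sum-triangle-antidiagonal : ∀ n (g : ℕ → ℕ → ℚ) →
  sumℚ n (λ k → sumℚ (n ∸ k) (g k)) ≡ sumℚ n (λ s → sumℚ (suc s) (λ k → g k (s ∸ k)))
sum-triangle-antidiagonal zero    g = refl
sum-triangle-antidiagonal (suc n) g = begin
  sumℚ (suc n) (λ k → sumℚ (suc n ∸ k) (g k))
    ≡⟨ sum-cong (suc n) (λ k k≤n → cong (λ t → sumℚ t (g k)) (ℕₚ.+-∸-assoc 1 (ℕₚ.≤-pred k≤n))) ⟩
  sumℚ (suc n) (λ k → sumℚ (n ∸ k) (g k) + g k (n ∸ k))
    ≡⟨ sum-+ (suc n) (λ k → sumℚ (n ∸ k) (g k)) (λ k → g k (n ∸ k)) ⟩
  sumℚ n (λ k → sumℚ (n ∸ k) (g k)) + sumℚ (n ∸ n) (g n) + sumℚ (suc n) (λ k → g k (n ∸ k))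
    ≡⟨ cong (λ t → sumℚ n (λ k → sumℚ (n ∸ k) (g k)) + sumℚ t (g n) + sumℚ (suc n) (λ k → g k (n ∸ k)))
            (ℕₚ.n∸n≡0 n) ⟩
  sumℚ n (λ k → sumℚ (n ∸ k) (g k)) + 0ℚ + sumℚ (suc n) (λ k → g k (n ∸ k))
    ≡⟨ cong (_+ sumℚ (suc n) (λ k → g k (n ∸ k)))
            (trans (ℚ.+-identityʳ _) (sum-triangle-antidiagonal n g)) ⟩
  sumℚ (suc n) (λ s → sumℚ (suc s) (λ k → g k (s ∸ k)))
    ∎
  where open ≡-Reasoning

sum-triangle : ∀ n (g : ℕ → ℕ → ℚ) →
  sumℚ n (λ k → sumℚ (n ∸ k) (g k)) ≡ sumℚ n (λ l → sumℚ (n ∸ l) (λ k → g k l))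
sum-triangle n g = begin
  sumℚ n (λ k → sumℚ (n ∸ k) (g k))                 ≡⟨ sum-triangle-antidiagonal n g ⟩
  sumℚ n (λ s → sumℚ (suc s) (λ k → g k (s ∸ k)))   ≡⟨ sum-cong n (λ s _ → reflect s) ⟩
  sumℚ n (λ s → sumℚ (suc s) (λ l → g (s ∸ l) l))   ≡⟨ sum-triangle-antidiagonal n (λ l k → g k l) ⟨
  sumℚ n (λ l → sumℚ (n ∸ l) (λ k → g k l))         ∎
  where
  open ≡-Reasoning
  reflect : ∀ s → sumℚ (suc s) (λ k → g k (s ∸ k)) ≡ sumℚ (suc s) (λ l → g (s ∸ l) l)
  reflect s = trans (sum-reverse s (λ k → g k (s ∸ k)))
                    (sum-cong (suc s) (λ l l≤s → cong (g (s ∸ l)) (ℕₚ.m∸[m∸n]≡n (ℕₚ.≤-pred l≤s))))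

-- Binomial theorem, Bernoulli numbers and Faulhaber's formula

0^-zero : ∀ {e} → 0 < e → 0ℚ ^ e ≡ 0ℚ
0^-zero {suc e} _ = ℚ.*-zeroˡ (0ℚ ^ e)

binomial : ∀ n x → (x + 1ℚ) ^ n ≡ sumℚ (suc n) (λ l → fromℕ (n C l) * x ^ l)
binomial zero    x = refl
binomial (suc n) x = begin
  (x + 1ℚ) * (x + 1ℚ) ^ n
    ≡⟨ cong ((x + 1ℚ) *_) (binomial n x) ⟩
  (x + 1ℚ) * sumℚ (suc n) c[n]
    ≡⟨ ℚ.*-distribʳ-+ (sumℚ (suc n) c[n]) x 1ℚ ⟩
  x * sumℚ (suc n) c[n] + 1ℚ * sumℚ (suc n) c[n]
    ≡⟨ cong₂ _+_ (*-distribˡ-sum (suc n) x c[n]) (ℚ.*-identityˡ _) ⟩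
  sumℚ (suc n) (λ l → x * c[n] l) + sumℚ (suc n) c[n]
    ≡⟨ cong₂ _+_ (sum-cong (suc n) λ l _ → swap x (fromℕ (n C l)) (x ^ l)) (sum-head n c[n]) ⟩
  sumℚ (suc n) (λ l → fromℕ (n C l) * x ^ suc l) + (1ℚ + sumℚ n (λ l → c[n] (suc l)))
    ≡⟨ cong (λ t → sumℚ (suc n) (λ l → fromℕ (n C l) * x ^ suc l) + (1ℚ + t)) top-vanishes ⟩
  sumℚ (suc n) (λ l → fromℕ (n C l) * x ^ suc l) + (1ℚ + sumℚ (suc n) (λ l → c[n] (suc l)))
    ≡⟨ rearrange (sumℚ (suc n) (λ l → fromℕ (n C l) * x ^ suc l)) (sumℚ (suc n) (λ l → c[n] (suc l))) ⟩
  1ℚ + (sumℚ (suc n) (λ l → fromℕ (n C l) * x ^ suc l) + sumℚ (suc n) (λ l → c[n] (suc l)))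
    ≡⟨ cong (λ t → 1ℚ + t) (sum-+ (suc n) _ _) ⟨
  1ℚ + sumℚ (suc n) (λ l → fromℕ (n C l) * x ^ suc l + c[n] (suc l))
    ≡⟨ cong (λ t → 1ℚ + t) (sum-cong (suc n) λ l _ → pascal l) ⟩
  1ℚ + sumℚ (suc n) (λ l → fromℕ (suc n C suc l) * x ^ suc l)
    ≡⟨ sum-head (suc n) (λ l → fromℕ (suc n C l) * x ^ l) ⟨
  sumℚ (suc (suc n)) (λ l → fromℕ (suc n C l) * x ^ l)
    ∎
  where
  open ≡-Reasoning
  c[n] : ℕ → ℚ
  c[n] l = fromℕ (n C l) * x ^ l
  swap : ∀ a b c → a * (b * c) ≡ b * (a * c)
  swap = solve-∀ ℚ-ring
  top-vanishes : sumℚ n (λ l → c[n] (suc l)) ≡ sumℚ (suc n) (λ l → c[n] (suc l))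
  top-vanishes = begin
    sumℚ n (λ l → c[n] (suc l))                                   ≡⟨ ℚ.+-identityʳ _ ⟨
    sumℚ n (λ l → c[n] (suc l)) + 0ℚ                              ≡⟨ cong (λ t → sumℚ n (λ l → c[n] (suc l)) + t) (ℚ.*-zeroˡ (x ^ suc n)) ⟨
    sumℚ n (λ l → c[n] (suc l)) + fromℕ 0 * x ^ suc n             ≡⟨ cong (λ c → sumℚ n (λ l → c[n] (suc l)) + fromℕ c * x ^ suc n)
                                                                       (k>n⇒nCk≡0 (ℕₚ.n<1+n n)) ⟨
    sumℚ (suc n) (λ l → c[n] (suc l))                             ∎
  rearrange : ∀ a b → a + (1ℚ + b) ≡ 1ℚ + (a + b)
  rearrange = solve-∀ ℚ-ring
  pascal : ∀ l → fromℕ (n C l) * x ^ suc l + c[n] (suc l) ≡ fromℕ (suc n C suc l) * x ^ suc l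
  pascal l = begin
    fromℕ (n C l) * x ^ suc l + fromℕ (n C suc l) * x ^ suc l   ≡⟨ ℚ.*-distribʳ-+ (x ^ suc l) (fromℕ (n C l)) (fromℕ (n C suc l)) ⟨
    (fromℕ (n C l) + fromℕ (n C suc l)) * x ^ suc l             ≡⟨ cong (_* x ^ suc l) (fromℕ-+ (n C l) (n C suc l)) ⟨
    fromℕ (n C l ℕ.+ n C suc l) * x ^ suc l                     ≡⟨ cong (λ c → fromℕ c * x ^ suc l) (nCk+nC[k+1]≡[n+1]C[k+1] n l) ⟩
    fromℕ (suc n C suc l) * x ^ suc l                           ∎

-- `bernoulli m` is the diagonal entry of a private table in `Defs` whose rows extend each other;
-- in `bernoulli-suc` unification recovers that table, so `table-diagonal` has no signature there.
stable-table-diagonal : {t : ℕ → ℕ → ℚ} → (∀ m k → k ≤ m → t (suc m) k ≡ t m k) →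
                        ∀ m k → k ≤ m → t m k ≡ t k k
stable-table-diagonal stable m k k≤m with ℕₚ.m≤n⇒m<n∨m≡n k≤m
... | inj₂ refl = refl
stable-table-diagonal stable (suc m) k _ | inj₁ (s≤s k≤m) =
  trans (stable m k k≤m) (stable-table-diagonal stable m k k≤m)

bernoulli-suc : ∀ m → bernoulli (suc m) ≡
  - (1/suc (suc m) * sumℚ (suc m) (λ k → fromℕ (suc (suc m) C k) * bernoulli k))
bernoulli-suc m = trans (if-cong (¬-not suc-m≰m))
  (cong (λ s → - (1/suc (suc m) * s)) (sum-cong (suc m) λ k k≤m →
    cong (fromℕ (suc (suc m) C k) *_) (table-diagonal m k (ℕₚ.≤-pred k≤m))))
  where
  table-diagonal = stable-table-diagonal {t = _} λ m′ k′ k′≤m′ →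
    if-cong {b = k′ ℕ.≤ᵇ m′} (Equivalence.to T-≡ (ℕₚ.≤⇒≤ᵇ k′≤m′))
  suc-m≰m : (suc m ℕ.≤ᵇ m) ≢ true
  suc-m≰m eq = ℕₚ.<-irrefl refl (ℕₚ.≤ᵇ⇒≤ (suc m) m (Equivalence.from T-≡ eq))

[1+n]C[n]≡1+n : ∀ n → suc n C n ≡ suc n
[1+n]C[n]≡1+n n = begin
  suc n C n               ≡⟨ nCk≡nC[n∸k] (ℕₚ.n≤1+n n) ⟩
  suc n C (suc n ∸ n)     ≡⟨ cong (suc n C_) (ℕₚ.m+n∸n≡m 1 n) ⟩
  suc n C 1               ≡⟨ nC1≡n (suc n) ⟩
  suc n                   ∎
  where open ≡-Reasoning

sum-binomial-bernoulli : ∀ n → sumℚ (suc (suc n)) (λ k → fromℕ (suc (suc n) C k) * bernoulli k) ≡ 0ℚ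
sum-binomial-bernoulli n = begin
  s + fromℕ (suc (suc n) C suc n) * bernoulli (suc n)      ≡⟨ cong₂ (λ c b → s + fromℕ c * b) ([1+n]C[n]≡1+n (suc n)) (bernoulli-suc n) ⟩
  s + fromℕ (suc (suc n)) * - (1/suc (suc n) * s)          ≡⟨ cancel s (1/suc (suc n)) (fromℕ (suc (suc n))) ⟩
  s - (1/suc (suc n) * fromℕ (suc (suc n))) * s            ≡⟨ cong (λ c → s - c * s) (1/suc-inverseˡ (suc n)) ⟩
  s - 1ℚ * s                                               ≡⟨ vanish s ⟩
  0ℚ                                                       ∎
  where
  open ≡-Reasoning
  s : ℚ
  s = sumℚ (suc n) (λ k → fromℕ (suc (suc n) C k) * bernoulli k)
  cancel : ∀ s a b → s + b * - (a * s) ≡ s - (a * b) * s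
  cancel = solve-∀ ℚ-ring
  vanish : ∀ s → s - 1ℚ * s ≡ 0ℚ
  vanish = solve-∀ ℚ-ring

C-*-factorials : ∀ {n k} → k ≤ n → (n C k) ℕ.* (k ! ℕ.* (n ∸ k) !) ≡ n !
C-*-factorials {n} {k} k≤n = begin
  (n C k) ℕ.* (k ! ℕ.* (n ∸ k) !)                 ≡⟨ cong (ℕ._* (k ! ℕ.* (n ∸ k) !)) (nCk≡n!/k![n-k]! k≤n) ⟩
  n ! ℕ./ (k ! ℕ.* (n ∸ k) !) ℕ.* (k ! ℕ.* (n ∸ k) !) ≡⟨ m/n*n≡m (k![n∸k]!∣n! k≤n) ⟩
  n !                                           ∎
  where
  open ≡-Reasoning
  instance
    factorials≢0 : NonZero (k ! ℕ.* (n ∸ k) !)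
    factorials≢0 = ℕₚ.m*n≢0 (k !) ((n ∸ k) !) {{ℕₚ._!≢0 k}} {{ℕₚ._!≢0 (n ∸ k)}}

C-*-C-*-factorials : ∀ {n k l} → k ℕ.+ l ≤ n →
  (n C k) ℕ.* ((n ∸ k) C l) ℕ.* (k ! ℕ.* (l ! ℕ.* (n ∸ (k ℕ.+ l)) !)) ≡ n !
C-*-C-*-factorials {n} {k} {l} k+l≤n = begin
  (n C k) ℕ.* ((n ∸ k) C l) ℕ.* (k ! ℕ.* (l ! ℕ.* (n ∸ (k ℕ.+ l)) !))
    ≡⟨ regroup (n C k) ((n ∸ k) C l) (k !) (l !) ((n ∸ (k ℕ.+ l)) !) ⟩
  (n C k) ℕ.* (k ! ℕ.* (((n ∸ k) C l) ℕ.* (l ! ℕ.* (n ∸ (k ℕ.+ l)) !)))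
    ≡⟨ cong (λ r → (n C k) ℕ.* (k ! ℕ.* (((n ∸ k) C l) ℕ.* (l ! ℕ.* r !)))) (ℕₚ.∸-+-assoc n k l) ⟨
  (n C k) ℕ.* (k ! ℕ.* (((n ∸ k) C l) ℕ.* (l ! ℕ.* (n ∸ k ∸ l) !)))
    ≡⟨ cong (λ r → (n C k) ℕ.* (k ! ℕ.* r)) (C-*-factorials l≤n∸k) ⟩
  (n C k) ℕ.* (k ! ℕ.* (n ∸ k) !)
    ≡⟨ C-*-factorials (ℕₚ.m+n≤o⇒m≤o k k+l≤n) ⟩
  n !
    ∎
  where
  open ≡-Reasoning
  l≤n∸k : l ≤ n ∸ k
  l≤n∸k = subst (_≤ n ∸ k) (ℕₚ.m+n∸m≡n k l) (ℕₚ.∸-monoˡ-≤ k k+l≤n)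
  regroup : ∀ a b c d e → a ℕ.* b ℕ.* (c ℕ.* (d ℕ.* e)) ≡ a ℕ.* (c ℕ.* (b ℕ.* (d ℕ.* e)))
  regroup = ℕ-Solver.solve-∀

C-*-C-comm : ∀ {n k l} → k ℕ.+ l ≤ n → (n C k) ℕ.* ((n ∸ k) C l) ≡ (n C l) ℕ.* ((n ∸ l) C k)
C-*-C-comm {n} {k} {l} k+l≤n = ℕₚ.*-cancelʳ-≡ _ _ (k ! ℕ.* (l ! ℕ.* (n ∸ (k ℕ.+ l)) !)) (begin
  (n C k) ℕ.* ((n ∸ k) C l) ℕ.* (k ! ℕ.* (l ! ℕ.* (n ∸ (k ℕ.+ l)) !))   ≡⟨ C-*-C-*-factorials {n} {k} {l} k+l≤n ⟩
  n !                                                                   ≡⟨ C-*-C-*-factorials {n} {l} {k} l+k≤n ⟨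
  (n C l) ℕ.* ((n ∸ l) C k) ℕ.* (l ! ℕ.* (k ! ℕ.* (n ∸ (l ℕ.+ k)) !))   ≡⟨ cong (λ j → (n C l) ℕ.* ((n ∸ l) C k) ℕ.* (l ! ℕ.* (k ! ℕ.* (n ∸ j) !))) (ℕₚ.+-comm l k) ⟩
  (n C l) ℕ.* ((n ∸ l) C k) ℕ.* (l ! ℕ.* (k ! ℕ.* (n ∸ (k ℕ.+ l)) !))   ≡⟨ cong (λ r → (n C l) ℕ.* ((n ∸ l) C k) ℕ.* r) (swap (l !) (k !) ((n ∸ (k ℕ.+ l)) !)) ⟩
  (n C l) ℕ.* ((n ∸ l) C k) ℕ.* (k ! ℕ.* (l ! ℕ.* (n ∸ (k ℕ.+ l)) !))   ∎)
  where
  open ≡-Reasoning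
  l+k≤n : l ℕ.+ k ≤ n
  l+k≤n = subst (_≤ n) (ℕₚ.+-comm k l) k+l≤n
  swap : ∀ a b c → a ℕ.* (b ℕ.* c) ≡ b ℕ.* (a ℕ.* c)
  swap = ℕ-Solver.solve-∀
  instance
    factorials≢0 : NonZero (k ! ℕ.* (l ! ℕ.* (n ∸ (k ℕ.+ l)) !))
    factorials≢0 = ℕₚ.m*n≢0 (k !) (l ! ℕ.* (n ∸ (k ℕ.+ l)) !) {{ℕₚ._!≢0 k}}
                     {{ℕₚ.m*n≢0 (l !) ((n ∸ (k ℕ.+ l)) !) {{ℕₚ._!≢0 l}} {{ℕₚ._!≢0 (n ∸ (k ℕ.+ l))}}}}

binomial-sub : ∀ n x → (x + 1ℚ) ^ n - x ^ n ≡ sumℚ n (λ l → fromℕ (n C l) * x ^ l)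
binomial-sub n x = begin
  (x + 1ℚ) ^ n - x ^ n                                                  ≡⟨ cong (_- x ^ n) (binomial n x) ⟩
  sumℚ n (λ l → fromℕ (n C l) * x ^ l) + fromℕ (n C n) * x ^ n - x ^ n  ≡⟨ cong (λ c → sumℚ n (λ l → fromℕ (n C l) * x ^ l) + fromℕ c * x ^ n - x ^ n) (nCn≡1 n) ⟩
  sumℚ n (λ l → fromℕ (n C l) * x ^ l) + 1ℚ * x ^ n - x ^ n             ≡⟨ cancel _ (x ^ n) ⟩
  sumℚ n (λ l → fromℕ (n C l) * x ^ l)                                  ∎
  where
  open ≡-Reasoning
  cancel : ∀ s y → s + 1ℚ * y - y ≡ s
  cancel = solve-∀ ℚ-ring

powerSum : ℕ → ℕ → ℚ
powerSum e n = sumℚ n (λ i → fromℕ i ^ e)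

-- B_{m+1}(x) - B_{m+1}, for the Bernoulli polynomial B_{m+1}(x).
faulhaberPolynomial : ℕ → ℚ → ℚ
faulhaberPolynomial m x = sumℚ (suc m) (λ k → fromℕ (suc m C k) * bernoulli k * x ^ (suc m ∸ k))

sum-binomial-bernoulli-below : ∀ m l → l < m → sumℚ (suc m ∸ l) (λ k → fromℕ ((suc m ∸ l) C k) * bernoulli k) ≡ 0ℚ
sum-binomial-bernoulli-below m l l<m
  rewrite ℕₚ.+-∸-assoc 1 (ℕₚ.<⇒≤ l<m) | ℕₚ.+-∸-assoc 1 l<m = sum-binomial-bernoulli (m ∸ suc l)

sum-binomial-bernoulli-top : ∀ m → sumℚ (suc m ∸ m) (λ k → fromℕ ((suc m ∸ m) C k) * bernoulli k) ≡ 1ℚ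
sum-binomial-bernoulli-top m rewrite ℕₚ.m+n∸n≡m 1 m = refl

faulhaberPolynomial-sub : ∀ m x → faulhaberPolynomial m (x + 1ℚ) - faulhaberPolynomial m x ≡ fromℕ (suc m) * x ^ m
faulhaberPolynomial-sub m x = begin
  faulhaberPolynomial m (x + 1ℚ) - faulhaberPolynomial m x
    ≡⟨ sum-- M (λ k → c k * (x + 1ℚ) ^ (M ∸ k)) (λ k → c k * x ^ (M ∸ k)) ⟨
  sumℚ M (λ k → c k * (x + 1ℚ) ^ (M ∸ k) - c k * x ^ (M ∸ k))
    ≡⟨ sum-cong M (λ k _ → trans (factor (c k) ((x + 1ℚ) ^ (M ∸ k)) (x ^ (M ∸ k))) (cong (c k *_) (binomial-sub (M ∸ k) x))) ⟩
  sumℚ M (λ k → c k * sumℚ (M ∸ k) (λ l → fromℕ ((M ∸ k) C l) * x ^ l))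
    ≡⟨ sum-cong M (λ k _ → *-distribˡ-sum (M ∸ k) (c k) (λ l → fromℕ ((M ∸ k) C l) * x ^ l)) ⟩
  sumℚ M (λ k → sumℚ (M ∸ k) (λ l → c k * (fromℕ ((M ∸ k) C l) * x ^ l)))
    ≡⟨ sum-triangle M (λ k l → c k * (fromℕ ((M ∸ k) C l) * x ^ l)) ⟩
  sumℚ M (λ l → sumℚ (M ∸ l) (λ k → c k * (fromℕ ((M ∸ k) C l) * x ^ l)))
    ≡⟨ sum-cong M (λ l l<M → sum-cong (M ∸ l) (λ k k<M∸l → exchange k l (k+l≤M k l l<M k<M∸l))) ⟩
  sumℚ M (λ l → sumℚ (M ∸ l) (λ k → d l * (fromℕ ((M ∸ l) C k) * bernoulli k)))
    ≡⟨ sum-cong M (λ l _ → *-distribˡ-sum (M ∸ l) (d l) (λ k → fromℕ ((M ∸ l) C k) * bernoulli k)) ⟨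
  sumℚ M (λ l → d l * inner l)
    ≡⟨ cong₂ _+_ (trans (sum-cong m λ l l<m → trans (cong (d l *_) (sum-binomial-bernoulli-below m l l<m)) (ℚ.*-zeroʳ (d l)))
                        (sum-zero m))
                 (trans (cong (d m *_) (sum-binomial-bernoulli-top m)) (ℚ.*-identityʳ (d m))) ⟩
  0ℚ + fromℕ (M C m) * x ^ m
    ≡⟨ trans (ℚ.+-identityˡ _) (cong (λ a → fromℕ a * x ^ m) ([1+n]C[n]≡1+n m)) ⟩
  fromℕ M * x ^ m
    ∎
  where
  open ≡-Reasoning
  M : ℕ
  M = suc m
  c d inner : ℕ → ℚ
  c k = fromℕ (M C k) * bernoulli k
  d l = fromℕ (M C l) * x ^ l
  inner l = sumℚ (M ∸ l) (λ k → fromℕ ((M ∸ l) C k) * bernoulli k)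
  factor : ∀ a y z → a * y - a * z ≡ a * (y - z)
  factor = solve-∀ ℚ-ring
  k+l≤M : ∀ k l → l < M → k < M ∸ l → k ℕ.+ l ≤ M
  k+l≤M k l l<M k<M∸l =
    ℕₚ.≤-trans (ℕₚ.+-monoˡ-≤ l (ℕₚ.<⇒≤ k<M∸l)) (ℕₚ.≤-reflexive (ℕₚ.m∸n+n≡m (ℕₚ.<⇒≤ l<M)))
  exchange : ∀ k l → k ℕ.+ l ≤ M →
    c k * (fromℕ ((M ∸ k) C l) * x ^ l) ≡ d l * (fromℕ ((M ∸ l) C k) * bernoulli k)
  exchange k l k+l≤M = begin
    fromℕ (M C k) * bernoulli k * (fromℕ ((M ∸ k) C l) * x ^ l)
      ≡⟨ regroup (fromℕ (M C k)) (bernoulli k) (fromℕ ((M ∸ k) C l)) (x ^ l) ⟩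
    fromℕ (M C k) * fromℕ ((M ∸ k) C l) * (x ^ l * bernoulli k)
      ≡⟨ cong (_* (x ^ l * bernoulli k)) (fromℕ-* (M C k) ((M ∸ k) C l)) ⟨
    fromℕ ((M C k) ℕ.* ((M ∸ k) C l)) * (x ^ l * bernoulli k)
      ≡⟨ cong (λ a → fromℕ a * (x ^ l * bernoulli k)) (C-*-C-comm {M} {k} {l} k+l≤M) ⟩
    fromℕ ((M C l) ℕ.* ((M ∸ l) C k)) * (x ^ l * bernoulli k)
      ≡⟨ cong (_* (x ^ l * bernoulli k)) (fromℕ-* (M C l) ((M ∸ l) C k)) ⟩
    fromℕ (M C l) * fromℕ ((M ∸ l) C k) * (x ^ l * bernoulli k)
      ≡⟨ regroup′ (fromℕ (M C l)) (fromℕ ((M ∸ l) C k)) (x ^ l) (bernoulli k) ⟩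
    fromℕ (M C l) * x ^ l * (fromℕ ((M ∸ l) C k) * bernoulli k)
      ∎
    where
    regroup : ∀ a b c y → a * b * (c * y) ≡ a * c * (y * b)
    regroup = solve-∀ ℚ-ring
    regroup′ : ∀ a c y b → a * c * (y * b) ≡ a * y * (c * b)
    regroup′ = solve-∀ ℚ-ring

faulhaber : ∀ m n → fromℕ (suc m) * powerSum m n ≡ faulhaberPolynomial m (fromℕ n)
faulhaber m zero    = trans (ℚ.*-zeroʳ (fromℕ (suc m))) (sym (trans (sum-cong (suc m) vanish) (sum-zero (suc m))))
  where
  vanish : ∀ k → k < suc m → fromℕ (suc m C k) * bernoulli k * 0ℚ ^ (suc m ∸ k) ≡ 0ℚ
  vanish k k<1+m = trans (cong (fromℕ (suc m C k) * bernoulli k *_) (0^-zero (ℕₚ.m<n⇒0<n∸m k<1+m)))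
                         (ℚ.*-zeroʳ (fromℕ (suc m C k) * bernoulli k))
faulhaber m (suc n) = begin
  fromℕ (suc m) * (powerSum m n + fromℕ n ^ m)                                  ≡⟨ ℚ.*-distribˡ-+ (fromℕ (suc m)) (powerSum m n) (fromℕ n ^ m) ⟩
  fromℕ (suc m) * powerSum m n + fromℕ (suc m) * fromℕ n ^ m                    ≡⟨ cong₂ _+_ (faulhaber m n) (sym (faulhaberPolynomial-sub m (fromℕ n))) ⟩
  faulhaberPolynomial m (fromℕ n) + (faulhaberPolynomial m (fromℕ n + 1ℚ) - faulhaberPolynomial m (fromℕ n))
                                                                                ≡⟨ telescope (faulhaberPolynomial m (fromℕ n)) (faulhaberPolynomial m (fromℕ n + 1ℚ)) ⟩
  faulhaberPolynomial m (fromℕ n + 1ℚ)                                          ≡⟨ cong (faulhaberPolynomial m) (trans (ℚ.+-comm (fromℕ n) 1ℚ) (sym (fromℕ-suc n))) ⟩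
  faulhaberPolynomial m (fromℕ (suc n))                                         ∎
  where
  open ≡-Reasoning
  telescope : ∀ a b → a + (b - a) ≡ b
  telescope = solve-∀ ℚ-ring

faulhaber-sum : ∀ m e n → fromℕ (suc m) * sumℚ n (λ J → powerSum m J * fromℕ J ^ e) ≡
  sumℚ (suc m) (λ k → fromℕ (suc m C k) * bernoulli k * powerSum (e ℕ.+ (suc m ∸ k)) n)
faulhaber-sum m e n = begin
  fromℕ M * sumℚ n (λ J → powerSum m J * fromℕ J ^ e)
    ≡⟨ *-distribˡ-sum n (fromℕ M) (λ J → powerSum m J * fromℕ J ^ e) ⟩
  sumℚ n (λ J → fromℕ M * (powerSum m J * fromℕ J ^ e))
    ≡⟨ sum-cong n (λ J _ → trans (sym (ℚ.*-assoc (fromℕ M) (powerSum m J) (fromℕ J ^ e)))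
                                 (cong (_* fromℕ J ^ e) (faulhaber m J))) ⟩
  sumℚ n (λ J → faulhaberPolynomial m (fromℕ J) * fromℕ J ^ e)
    ≡⟨ sum-cong n (λ J _ → *-distribʳ-sum M (fromℕ J ^ e) (λ k → c k * fromℕ J ^ (M ∸ k))) ⟩
  sumℚ n (λ J → sumℚ M (λ k → c k * fromℕ J ^ (M ∸ k) * fromℕ J ^ e))
    ≡⟨ sum-cong n (λ J _ → sum-cong M λ k _ → merge J k) ⟩
  sumℚ n (λ J → sumℚ M (λ k → c k * fromℕ J ^ (e ℕ.+ (M ∸ k))))
    ≡⟨ sum-comm n M (λ J k → c k * fromℕ J ^ (e ℕ.+ (M ∸ k))) ⟩
  sumℚ M (λ k → sumℚ n (λ J → c k * fromℕ J ^ (e ℕ.+ (M ∸ k))))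
    ≡⟨ sum-cong M (λ k _ → sym (*-distribˡ-sum n (c k) (λ J → fromℕ J ^ (e ℕ.+ (M ∸ k))))) ⟩
  sumℚ M (λ k → c k * powerSum (e ℕ.+ (M ∸ k)) n)
    ∎
  where
  open ≡-Reasoning
  M : ℕ
  M = suc m
  c : ℕ → ℚ
  c k = fromℕ (M C k) * bernoulli k
  merge : ∀ J k → c k * fromℕ J ^ (M ∸ k) * fromℕ J ^ e ≡ c k * fromℕ J ^ (e ℕ.+ (M ∸ k))
  merge J k = begin
    c k * fromℕ J ^ (M ∸ k) * fromℕ J ^ e     ≡⟨ ℚ.*-assoc (c k) (fromℕ J ^ (M ∸ k)) (fromℕ J ^ e) ⟩
    c k * (fromℕ J ^ (M ∸ k) * fromℕ J ^ e)   ≡⟨ cong (c k *_) (ℚ.*-comm (fromℕ J ^ (M ∸ k)) (fromℕ J ^ e)) ⟩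
    c k * (fromℕ J ^ e * fromℕ J ^ (M ∸ k))   ≡⟨ cong (c k *_) (^-homo-* (fromℕ J) e (M ∸ k)) ⟨
    c k * fromℕ J ^ (e ℕ.+ (M ∸ k))           ∎

-- Rearranging the left-hand side

invSq2≡1/suc⁴ : ∀ i j → invSq2 i j ≡ 1/suc i * 1/suc i * 1/suc j * 1/suc j
invSq2≡1/suc⁴ i j = begin
  invSq2 i j                                  ≡⟨ 1/suc-* (j ℕ.+ (i ℕ.+ i ℕ.* suc i) ℕ.* suc j) j ⟩
  (+ 1) / (suc i ℕ.* suc i ℕ.* suc j) * 1/suc j  ≡⟨ cong (_* 1/suc j) (1/suc-* (i ℕ.+ i ℕ.* suc i) j) ⟩
  (+ 1) / (suc i ℕ.* suc i) * 1/suc j * 1/suc j  ≡⟨ cong (λ a → a * 1/suc j * 1/suc j) (1/suc-* i i) ⟩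
  1/suc i * 1/suc i * 1/suc j * 1/suc j       ∎
  where open ≡-Reasoning

j[j+1]a/[j+1]²≡a-a/[j+1] : ∀ j a → fromℕ j * fromℕ (suc j) * (a * 1/suc j * 1/suc j) ≡ a - a * 1/suc j
j[j+1]a/[j+1]²≡a-a/[j+1] j a = begin
  y * fromℕ (suc j) * (a * w * w)                  ≡⟨ cong (λ z → y * z * (a * w * w)) (fromℕ-suc j) ⟩
  y * (1ℚ + y) * (a * w * w)                       ≡⟨ regroup y a w ⟩
  a * ((1ℚ + y) * w - w) * ((1ℚ + y) * w)          ≡⟨ cong (λ z → a * (z - w) * z) [1+y]w≡1 ⟩
  a * (1ℚ - w) * 1ℚ                                ≡⟨ simplify a w ⟩
  a - a * w                                        ∎
  where
  open ≡-Reasoning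
  y w : ℚ
  y = fromℕ j
  w = 1/suc j
  [1+y]w≡1 : (1ℚ + y) * w ≡ 1ℚ
  [1+y]w≡1 = trans (ℚ.*-comm (1ℚ + y) w) (trans (cong (w *_) (sym (fromℕ-suc j))) (1/suc-inverseˡ j))
  regroup : ∀ y a w → y * (1ℚ + y) * (a * w * w) ≡ a * ((1ℚ + y) * w - w) * ((1ℚ + y) * w)
  regroup = solve-∀ ℚ-ring
  simplify : ∀ a w → a * (1ℚ - w) * 1ℚ ≡ a - a * w
  simplify = solve-∀ ℚ-ring

sum-powers≡sum-powerSum : ∀ m e n → 0 < m →
  sumℚ n (λ j → sumℚ j (λ i → fromℕ (suc i) ^ m - fromℕ (suc i) ^ m * fromℕ (suc j) ^ e)) ≡
  sumℚ (suc n) (λ J → powerSum m J - powerSum m J * fromℕ J ^ e)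
sum-powers≡sum-powerSum m e n 0<m = sym (begin
  sumℚ (suc n) (λ J → powerSum m J - powerSum m J * fromℕ J ^ e)
    ≡⟨ sum-head n (λ J → powerSum m J - powerSum m J * fromℕ J ^ e) ⟩
  0ℚ - 0ℚ * 0ℚ ^ e + sumℚ n (λ j → powerSum m (suc j) - powerSum m (suc j) * fromℕ (suc j) ^ e)
    ≡⟨ cong₂ _+_ (vanish (0ℚ ^ e)) (sum-cong n λ j _ → expand j) ⟩
  0ℚ + sumℚ n (λ j → sumℚ j (λ i → fromℕ (suc i) ^ m - fromℕ (suc i) ^ m * fromℕ (suc j) ^ e))
    ≡⟨ ℚ.+-identityˡ _ ⟩
  sumℚ n (λ j → sumℚ j (λ i → fromℕ (suc i) ^ m - fromℕ (suc i) ^ m * fromℕ (suc j) ^ e))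
    ∎)
  where
  open ≡-Reasoning
  vanish : ∀ z → 0ℚ - 0ℚ * z ≡ 0ℚ
  vanish = solve-∀ ℚ-ring
  powerSum-suc : ∀ j → powerSum m (suc j) ≡ sumℚ j (λ i → fromℕ (suc i) ^ m)
  powerSum-suc j = begin
    powerSum m (suc j)                              ≡⟨ sum-head j (λ i → fromℕ i ^ m) ⟩
    0ℚ ^ m + sumℚ j (λ i → fromℕ (suc i) ^ m)       ≡⟨ cong (_+ sumℚ j (λ i → fromℕ (suc i) ^ m)) (0^-zero 0<m) ⟩
    0ℚ + sumℚ j (λ i → fromℕ (suc i) ^ m)           ≡⟨ ℚ.+-identityˡ _ ⟩
    sumℚ j (λ i → fromℕ (suc i) ^ m)                ∎
  expand : ∀ j → powerSum m (suc j) - powerSum m (suc j) * fromℕ (suc j) ^ e ≡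
                 sumℚ j (λ i → fromℕ (suc i) ^ m - fromℕ (suc i) ^ m * fromℕ (suc j) ^ e)
  expand j = begin
    powerSum m (suc j) - powerSum m (suc j) * fromℕ (suc j) ^ e
      ≡⟨ cong (λ s → s - s * fromℕ (suc j) ^ e) (powerSum-suc j) ⟩
    sumℚ j (λ i → fromℕ (suc i) ^ m) - sumℚ j (λ i → fromℕ (suc i) ^ m) * fromℕ (suc j) ^ e
      ≡⟨ cong (λ t → sumℚ j (λ i → fromℕ (suc i) ^ m) - t) (*-distribʳ-sum j (fromℕ (suc j) ^ e) (λ i → fromℕ (suc i) ^ m)) ⟩
    sumℚ j (λ i → fromℕ (suc i) ^ m) - sumℚ j (λ i → fromℕ (suc i) ^ m * fromℕ (suc j) ^ e)
      ≡⟨ sum-- j (λ i → fromℕ (suc i) ^ m) (λ i → fromℕ (suc i) ^ m * fromℕ (suc j) ^ e) ⟨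
    sumℚ j (λ i → fromℕ (suc i) ^ m - fromℕ (suc i) ^ m * fromℕ (suc j) ^ e)
      ∎

½ : ℚ
½ = 1/suc 1

-½ : ℚ
-½ = - ½

-- The weight of g j is Σ_{j<k≤n} k = ((n+1) n - j (j+1)) / 2.
sum-*-prefixSum : ∀ n (g : ℕ → ℚ) → sumℚ (suc n) (λ k → fromℕ k * sumℚ k g) ≡
  sumℚ n (λ j → ½ * (fromℕ (suc n) * fromℕ n - fromℕ j * fromℕ (suc j)) * g j)
sum-*-prefixSum zero    g = trans (ℚ.+-identityˡ (fromℕ 0 * 0ℚ)) (ℚ.*-zeroʳ (fromℕ 0))
sum-*-prefixSum (suc n) g = begin
  sumℚ (suc n) (λ k → fromℕ k * sumℚ k g) + x * (sumℚ n g + g n)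
    ≡⟨ cong (_+ x * (sumℚ n g + g n)) (sum-*-prefixSum n g) ⟩
  sumℚ n (λ j → w n j * g j) + x * (sumℚ n g + g n)
    ≡⟨ regroup (sumℚ n (λ j → w n j * g j)) x (sumℚ n g) (g n) ⟩
  sumℚ n (λ j → w n j * g j) + x * sumℚ n g + x * g n
    ≡⟨ cong (λ s → sumℚ n (λ j → w n j * g j) + s + x * g n) (*-distribˡ-sum n x g) ⟩
  sumℚ n (λ j → w n j * g j) + sumℚ n (λ j → x * g j) + x * g n
    ≡⟨ cong (_+ x * g n) (sum-+ n (λ j → w n j * g j) (λ j → x * g j)) ⟨
  sumℚ n (λ j → w n j * g j + x * g j) + x * g n
    ≡⟨ cong₂ _+_ (sum-cong n λ j _ → trans (sym (ℚ.*-distribʳ-+ (g j) (w n j) x)) (cong (_* g j) (w-step j)))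
                 (cong (_* g n) w-diagonal) ⟩
  sumℚ n (λ j → w (suc n) j * g j) + w (suc n) n * g n
    ∎
  where
  open ≡-Reasoning
  x : ℚ
  x = fromℕ (suc n)
  w : ℕ → ℕ → ℚ
  w n j = ½ * (fromℕ (suc n) * fromℕ n - fromℕ j * fromℕ (suc j))
  regroup : ∀ a x s b → a + x * (s + b) ≡ a + x * s + x * b
  regroup = solve-∀ ℚ-ring
  w-step : ∀ j → w n j + x ≡ w (suc n) j
  w-step j = begin
    ½ * (x * t - y) + x                              ≡⟨ cong₂ (λ a b → ½ * (a * t - y) + b) (fromℕ-suc n) (fromℕ-suc n) ⟩
    ½ * ((1ℚ + t) * t - y) + (1ℚ + t)                ≡⟨ cong (λ c → ½ * ((1ℚ + t) * t - y) + c) (ℚ.*-identityˡ (1ℚ + t)) ⟨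
      -- ½ + ½ normalises to 1ℚ
    ½ * ((1ℚ + t) * t - y) + (½ + ½) * (1ℚ + t)      ≡⟨ expand ½ t y ⟩
    ½ * ((1ℚ + (1ℚ + t)) * (1ℚ + t) - y)             ≡⟨ cong₂ (λ a b → ½ * (a * b - y)) (fromℕ-2+ n) (fromℕ-suc n) ⟨
    w (suc n) j                                      ∎
    where
    t y : ℚ
    t = fromℕ n
    y = fromℕ j * fromℕ (suc j)
    expand : ∀ h t y → h * ((1ℚ + t) * t - y) + (h + h) * (1ℚ + t) ≡ h * ((1ℚ + (1ℚ + t)) * (1ℚ + t) - y)
    expand = solve-∀ ℚ-ring
  w-diagonal : x ≡ w (suc n) n
  w-diagonal = begin
    x                                                ≡⟨ fromℕ-suc n ⟩
    1ℚ + t                                           ≡⟨ ℚ.*-identityˡ (1ℚ + t) ⟨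
    (½ + ½) * (1ℚ + t)                               ≡⟨ expand ½ t ⟩
    ½ * ((1ℚ + (1ℚ + t)) * (1ℚ + t) - t * (1ℚ + t))  ≡⟨ cong₂ (λ a b → ½ * (a * b - t * b)) (fromℕ-2+ n) (fromℕ-suc n) ⟨
    w (suc n) n                                      ∎
    where
    t : ℚ
    t = fromℕ n
    expand : ∀ h t → (h + h) * (1ℚ + t) ≡ h * ((1ℚ + (1ℚ + t)) * (1ℚ + t) - t * (1ℚ + t))
    expand = solve-∀ ℚ-ring

module Modulo (p′ : ℕ) (p-prime : Prime (suc p′)) where

  p : ℕ
  p = suc p′

  p∤1 : p ∤ 1
  p∤1 p∣1 = ¬prime[1] (subst Prime (∣1⇒≡1 p∣1) p-prime)

  p∤* : ∀ {a b} → p ∤ a → p ∤ b → p ∤ a ℕ.* b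
  p∤* {a} {b} p∤a p∤b p∣ab = [ p∤a , p∤b ] (euclidsLemma a b p-prime p∣ab)

  p∤<p : ∀ {n} → suc n < p → p ∤ suc n
  p∤<p n<p p∣n = ℕₚ.<⇒≱ n<p (∣⇒≤ p∣n)

  p∤! : ∀ {n} → n < p → p ∤ n !
  p∤! {zero}  _     = p∤1
  p∤! {suc n} 1+n<p = p∤* (p∤<p 1+n<p) (p∤! (ℕₚ.<-trans (ℕₚ.n<1+n n) 1+n<p))

  p∣pCk : ∀ {k} → suc k < p → p ∣ p C suc k
  p∣pCk {k} 1+k<p = [ id , (λ p∣factorials → ⊥-elim (p∤* (p∤! 1+k<p) (p∤! (s≤s (ℕₚ.m∸n≤m p′ k))) p∣factorials)) ]
    (euclidsLemma (p C suc k) (suc k ! ℕ.* (p ∸ suc k) !) p-prime p∣pCk*factorials)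
    where
    p∣pCk*factorials : p ∣ (p C suc k) ℕ.* (suc k ! ℕ.* (p ∸ suc k) !)
    p∣pCk*factorials = subst (p ∣_) (sym (C-*-factorials (ℕₚ.<⇒≤ 1+k<p))) (∣m⇒∣m*n (p′ !) (∣-refl {p}))

  record Integral (x : ℚ) : Set where
    constructor integral
    field
      denominator   : ℕ
      p∤denominator : p ∤ denominator
      numerator     : ℤ
      cleared       : x * fromℕ denominator ≡ fromℤ numerator

  fromℤ-integral : ∀ i → Integral (fromℤ i)
  fromℤ-integral i = integral 1 p∤1 i (ℚ.*-identityʳ (fromℤ i))

  fromℕ-integral : ∀ n → Integral (fromℕ n)
  fromℕ-integral n = fromℤ-integral (+ n)

  1/suc-integral : ∀ {n} → suc n < p → Integral (1/suc n)
  1/suc-integral {n} 1+n<p = integral (suc n) (p∤<p 1+n<p) (+ 1) (1/suc-inverseˡ n)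

  +-integral : ∀ {x y} → Integral x → Integral y → Integral (x + y)
  +-integral {x} {y} (integral b p∤b a x*b≡a) (integral d p∤d c y*d≡c) =
    integral (b ℕ.* d) (p∤* p∤b p∤d) (a ℤ.* + d ℤ.+ c ℤ.* + b) (begin
      (x + y) * fromℕ (b ℕ.* d)                       ≡⟨ cong ((x + y) *_) (fromℕ-* b d) ⟩
      (x + y) * (fromℕ b * fromℕ d)                   ≡⟨ expand x y (fromℕ b) (fromℕ d) ⟩
      x * fromℕ b * fromℕ d + y * fromℕ d * fromℕ b   ≡⟨ cong₂ (λ s t → s * fromℕ d + t * fromℕ b) x*b≡a y*d≡c ⟩
      fromℤ a * fromℕ d + fromℤ c * fromℕ b           ≡⟨ cong₂ _+_ (fromℤ-* a (+ d)) (fromℤ-* c (+ b)) ⟨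
      fromℤ (a ℤ.* + d) + fromℤ (c ℤ.* + b)           ≡⟨ fromℤ-+ (a ℤ.* + d) (c ℤ.* + b) ⟨
      fromℤ (a ℤ.* + d ℤ.+ c ℤ.* + b)                 ∎)
    where
    open ≡-Reasoning
    expand : ∀ x y b d → (x + y) * (b * d) ≡ x * b * d + y * d * b
    expand = solve-∀ ℚ-ring

  *-integral : ∀ {x y} → Integral x → Integral y → Integral (x * y)
  *-integral {x} {y} (integral b p∤b a x*b≡a) (integral d p∤d c y*d≡c) =
    integral (b ℕ.* d) (p∤* p∤b p∤d) (a ℤ.* c) (begin
      x * y * fromℕ (b ℕ.* d)               ≡⟨ cong (x * y *_) (fromℕ-* b d) ⟩
      x * y * (fromℕ b * fromℕ d)           ≡⟨ regroup x y (fromℕ b) (fromℕ d) ⟩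
      x * fromℕ b * (y * fromℕ d)           ≡⟨ cong₂ _*_ x*b≡a y*d≡c ⟩
      fromℤ a * fromℤ c                     ≡⟨ fromℤ-* a c ⟨
      fromℤ (a ℤ.* c)                       ∎)
    where
    open ≡-Reasoning
    regroup : ∀ x y b d → x * y * (b * d) ≡ x * b * (y * d)
    regroup = solve-∀ ℚ-ring

  neg-integral : ∀ {x} → Integral x → Integral (- x)
  neg-integral {x} (integral b p∤b a x*b≡a) = integral b p∤b (ℤ.- a) (begin
    - x * fromℕ b         ≡⟨ ℚ.neg-distribˡ-* x (fromℕ b) ⟨
    - (x * fromℕ b)       ≡⟨ cong -_ x*b≡a ⟩
    - fromℤ a             ≡⟨ fromℤ-neg a ⟨
    fromℤ (ℤ.- a)         ∎)
    where open ≡-Reasoning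

  sum-integral : ∀ n {f} → (∀ i → i < n → Integral (f i)) → Integral (sumℚ n f)
  sum-integral zero    _        = fromℤ-integral (+ 0)
  sum-integral (suc n) integral-f = +-integral (sum-integral n λ i i<n → integral-f i (ℕₚ.m<n⇒m<1+n i<n))
                                                (integral-f n (ℕₚ.n<1+n n))

  ^-integral : ∀ {x} n → Integral x → Integral (x ^ n)
  ^-integral zero    _          = fromℤ-integral (+ 1)
  ^-integral (suc n) integral-x = *-integral integral-x (^-integral n integral-x)

  infix 4 _≈_
  record _≈_ (x y : ℚ) : Set where
    constructor congruent
    field
      quotient          : ℚ
      quotient-integral : Integral quotient
      difference        : x - y ≡ fromℕ p * quotient

  ≈-reflexive : ∀ {x y} → x ≡ y → x ≈ y
  ≈-reflexive {x} refl = congruent 0ℚ (fromℤ-integral (+ 0)) (vanish x (fromℕ p))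
    where
    vanish : ∀ x p → x - x ≡ p * 0ℚ
    vanish = solve-∀ ℚ-ring

  ≈-refl : ∀ {x} → x ≈ x
  ≈-refl = ≈-reflexive refl

  ≈-sym : ∀ {x y} → x ≈ y → y ≈ x
  ≈-sym {x} {y} (congruent q integral-q x-y≡pq) = congruent (- q) (neg-integral integral-q) (begin
    y - x                 ≡⟨ flip x y ⟩
    - (x - y)             ≡⟨ cong -_ x-y≡pq ⟩
    - (fromℕ p * q)       ≡⟨ ℚ.neg-distribʳ-* (fromℕ p) q ⟩
    fromℕ p * - q         ∎)
    where
    open ≡-Reasoning
    flip : ∀ x y → y - x ≡ - (x - y)
    flip = solve-∀ ℚ-ring

  ≈-trans : ∀ {x y z} → x ≈ y → y ≈ z → x ≈ z
  ≈-trans {x} {y} {z} (congruent q integral-q x-y≡pq) (congruent r integral-r y-z≡pr) =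
    congruent (q + r) (+-integral integral-q integral-r) (begin
      x - z                        ≡⟨ split x y z ⟩
      (x - y) + (y - z)            ≡⟨ cong₂ _+_ x-y≡pq y-z≡pr ⟩
      fromℕ p * q + fromℕ p * r    ≡⟨ ℚ.*-distribˡ-+ (fromℕ p) q r ⟨
      fromℕ p * (q + r)            ∎)
    where
    open ≡-Reasoning
    split : ∀ x y z → x - z ≡ (x - y) + (y - z)
    split = solve-∀ ℚ-ring

  ≈-setoid : Setoid 0ℓ 0ℓ
  ≈-setoid = record
    { Carrier       = ℚ
    ; _≈_           = _≈_
    ; isEquivalence = record { refl = ≈-refl ; sym = ≈-sym ; trans = ≈-trans }
    }

  module ≈-Reasoning = SetoidReasoning ≈-setoid

  +-cong : ∀ {x y u v} → x ≈ y → u ≈ v → x + u ≈ y + v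
  +-cong {x} {y} {u} {v} (congruent q integral-q x-y≡pq) (congruent r integral-r u-v≡pr) =
    congruent (q + r) (+-integral integral-q integral-r) (begin
      x + u - (y + v)              ≡⟨ regroup x y u v ⟩
      (x - y) + (u - v)            ≡⟨ cong₂ _+_ x-y≡pq u-v≡pr ⟩
      fromℕ p * q + fromℕ p * r    ≡⟨ ℚ.*-distribˡ-+ (fromℕ p) q r ⟨
      fromℕ p * (q + r)            ∎)
    where
    open ≡-Reasoning
    regroup : ∀ x y u v → x + u - (y + v) ≡ (x - y) + (u - v)
    regroup = solve-∀ ℚ-ring

  -‿cong : ∀ {x y} → x ≈ y → - x ≈ - y
  -‿cong {x} {y} (congruent q integral-q x-y≡pq) = congruent (- q) (neg-integral integral-q) (begin
    - x - - y             ≡⟨ regroup x y ⟩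
    - (x - y)             ≡⟨ cong -_ x-y≡pq ⟩
    - (fromℕ p * q)       ≡⟨ ℚ.neg-distribʳ-* (fromℕ p) q ⟩
    fromℕ p * - q         ∎)
    where
    open ≡-Reasoning
    regroup : ∀ x y → - x - - y ≡ - (x - y)
    regroup = solve-∀ ℚ-ring

  -- The product of congruences needs integrality of one factor on each side: x u - y v = x (u - v) + (x - y) v.
  *-cong : ∀ {x y u v} → Integral x → Integral v → x ≈ y → u ≈ v → x * u ≈ y * v
  *-cong {x} {y} {u} {v} integral-x integral-v (congruent q integral-q x-y≡pq) (congruent r integral-r u-v≡pr) =
    congruent (x * r + q * v) (+-integral (*-integral integral-x integral-r) (*-integral integral-q integral-v)) (begin
      x * u - y * v                        ≡⟨ split x y u v ⟩
      x * (u - v) + (x - y) * v            ≡⟨ cong₂ (λ s t → x * s + t * v) u-v≡pr x-y≡pq ⟩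
      x * (fromℕ p * r) + fromℕ p * q * v  ≡⟨ regroup x v (fromℕ p) q r ⟩
      fromℕ p * (x * r + q * v)            ∎)
    where
    open ≡-Reasoning
    split : ∀ x y u v → x * u - y * v ≡ x * (u - v) + (x - y) * v
    split = solve-∀ ℚ-ring
    regroup : ∀ x v p q r → x * (p * r) + p * q * v ≡ p * (x * r + q * v)
    regroup = solve-∀ ℚ-ring

  *-congˡ : ∀ {c u v} → Integral c → Integral v → u ≈ v → c * u ≈ c * v
  *-congˡ integral-c integral-v = *-cong integral-c integral-v ≈-refl

  sum-cong-≈ : ∀ n {f g} → (∀ i → i < n → f i ≈ g i) → sumℚ n f ≈ sumℚ n g
  sum-cong-≈ zero    _   = ≈-refl
  sum-cong-≈ (suc n) f≈g = +-cong (sum-cong-≈ n λ i i<n → f≈g i (ℕₚ.m<n⇒m<1+n i<n)) (f≈g n (ℕₚ.n<1+n n))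

  multiple-of-p≈0 : ∀ {n} → p ∣ n → fromℕ n ≈ 0ℚ
  multiple-of-p≈0 (divides q refl) = congruent (fromℕ q) (fromℕ-integral q)
    (trans (ℚ.+-identityʳ (fromℕ (q ℕ.* p))) (trans (fromℕ-* q p) (ℚ.*-comm (fromℕ q) (fromℕ p))))

  p≈0 : fromℕ p ≈ 0ℚ
  p≈0 = multiple-of-p≈0 (∣-refl {p})

  p*≈0 : ∀ {y} → Integral y → fromℕ p * y ≈ 0ℚ
  p*≈0 {y} integral-y = ≈-trans (*-cong (fromℕ-integral p) integral-y p≈0 ≈-refl) (≈-reflexive (ℚ.*-zeroˡ y))

  ≈⇒≡[modℚ] : ∀ {x y} → x ≈ y → x ≡ y [modℚ p ]
  ≈⇒≡[modℚ] {x} {y} (congruent q (integral b p∤b a q*b≡a) x-y≡pq) =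
    [ id , (λ p∣b → ⊥-elim (p∤b p∣b)) ] (euclidsLemma ℤ.∣ ↥ (x - y) ∣ b p-prime p∣↥[x-y]*b)
    where
    cleared : (x - y) * fromℕ b ≡ fromℤ (+ p ℤ.* a)
    cleared = begin
      (x - y) * fromℕ b          ≡⟨ cong (_* fromℕ b) x-y≡pq ⟩
      fromℕ p * q * fromℕ b      ≡⟨ ℚ.*-assoc (fromℕ p) q (fromℕ b) ⟩
      fromℕ p * (q * fromℕ b)    ≡⟨ cong (fromℕ p *_) q*b≡a ⟩
      fromℕ p * fromℤ a          ≡⟨ fromℤ-* (+ p) a ⟨
      fromℤ (+ p ℤ.* a)          ∎
      where open ≡-Reasoning
    p∣↥[x-y]*b : p ∣ ℤ.∣ ↥ (x - y) ∣ ℕ.* b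
    p∣↥[x-y]*b = subst (p ∣_) (begin
      p ℕ.* ℤ.∣ a ∣ ℕ.* ℤ.∣ ↧ (x - y) ∣   ≡⟨ cong (ℕ._* ℤ.∣ ↧ (x - y) ∣) (ℤₚ.abs-* (+ p) a) ⟨
      ℤ.∣ + p ℤ.* a ∣ ℕ.* ℤ.∣ ↧ (x - y) ∣ ≡⟨ ℤₚ.abs-* (+ p ℤ.* a) (↧ (x - y)) ⟨
      ℤ.∣ + p ℤ.* a ℤ.* ↧ (x - y) ∣       ≡⟨ cong ℤ.∣_∣ (↥*≡*↧ (x - y) b (+ p ℤ.* a) cleared) ⟨
      ℤ.∣ ↥ (x - y) ℤ.* + b ∣             ≡⟨ ℤₚ.abs-* (↥ (x - y)) (+ b) ⟩
      ℤ.∣ ↥ (x - y) ∣ ℕ.* b               ∎)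
      (∣m⇒∣m*n ℤ.∣ ↧ (x - y) ∣ (∣m⇒∣m*n ℤ.∣ a ∣ (∣-refl {p})))
      where open ≡-Reasoning

  fermat : ∀ n → fromℕ n ^ p ≈ fromℕ n
  fermat zero    = ≈-reflexive (ℚ.*-zeroˡ (0ℚ ^ p′))
  fermat (suc n) = begin
    fromℕ (suc n) ^ p                   ≡⟨ cong (_^ p) (trans (fromℕ-suc n) (ℚ.+-comm 1ℚ x)) ⟩
    (x + 1ℚ) ^ p                        ≡⟨ binomial p x ⟩
    sumℚ p c + c p                      ≡⟨ cong (_+ c p) (sum-head p′ c) ⟩
    c 0 + sumℚ p′ (λ l → c (suc l)) + c p
                                        ≈⟨ +-cong (+-cong (≈-refl {c 0}) middle≈0) (≈-refl {c p}) ⟩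
    c 0 + 0ℚ + c p                      ≡⟨ cong (λ d → 1ℚ * 1ℚ + 0ℚ + fromℕ d * x ^ p) (nCn≡1 p) ⟩
    1ℚ * 1ℚ + 0ℚ + 1ℚ * x ^ p           ≡⟨ simplify (x ^ p) ⟩
    1ℚ + x ^ p                          ≈⟨ +-cong (≈-refl {1ℚ}) (fermat n) ⟩
    1ℚ + x                              ≡⟨ fromℕ-suc n ⟨
    fromℕ (suc n)                       ∎
    where
    open ≈-Reasoning
    x : ℚ
    x = fromℕ n
    c : ℕ → ℚ
    c l = fromℕ (p C l) * x ^ l
    middle≈0 : sumℚ p′ (λ l → c (suc l)) ≈ 0ℚ
    middle≈0 = ≈-trans (sum-cong-≈ p′ λ l l<p′ → ≈-trans
                 (*-cong (fromℕ-integral (p C suc l)) (^-integral (suc l) (fromℕ-integral n))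
                         (multiple-of-p≈0 (p∣pCk (s≤s l<p′))) (≈-refl {x ^ suc l}))
                 (≈-reflexive (ℚ.*-zeroˡ (x ^ suc l))))
               (≈-reflexive (sum-zero p′))
    simplify : ∀ y → 1ℚ * 1ℚ + 0ℚ + 1ℚ * y ≡ 1ℚ + y
    simplify = solve-∀ ℚ-ring

  fromℕ-*-invertˡ : ∀ {n x y} → suc n < p → Integral y → fromℕ (suc n) * x ≈ y → x ≈ 1/suc n * y
  fromℕ-*-invertˡ {n} {x} {y} 1+n<p integral-y nx≈y = begin
    x                               ≡⟨ ℚ.*-identityˡ x ⟨
    1ℚ * x                          ≡⟨ cong (_* x) (1/suc-inverseˡ n) ⟨
    1/suc n * fromℕ (suc n) * x     ≡⟨ ℚ.*-assoc (1/suc n) (fromℕ (suc n)) x ⟩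
    1/suc n * (fromℕ (suc n) * x)   ≈⟨ *-congˡ (1/suc-integral 1+n<p) integral-y nx≈y ⟩
    1/suc n * y                     ∎
    where open ≈-Reasoning

  fermat-unit : ∀ {n} → suc n < p → fromℕ (suc n) ^ p′ ≈ 1ℚ
  fermat-unit {n} 1+n<p = ≈-trans (fromℕ-*-invertˡ 1+n<p (fromℕ-integral (suc n)) (fermat (suc n)))
                                  (≈-reflexive (1/suc-inverseˡ n))

  bernoulli-integral : ∀ {k} → suc k < p → Integral (bernoulli k)
  bernoulli-integral {k} 1+k<p = up-to k 1+k<p k ℕₚ.≤-refl
    where
    up-to : ∀ n → suc n < p → ∀ k → k ≤ n → Integral (bernoulli k)
    up-to zero    _     zero z≤n = fromℤ-integral (+ 1)
    up-to (suc n) 2+n<p k k≤1+n with ℕₚ.m≤n⇒m<n∨m≡n k≤1+n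
    ... | inj₁ (s≤s k≤n) = up-to n (ℕₚ.<-trans (ℕₚ.n<1+n (suc n)) 2+n<p) k k≤n
    ... | inj₂ refl      = subst Integral (sym (bernoulli-suc n))
      (neg-integral (*-integral (1/suc-integral 2+n<p)
        (sum-integral (suc n) λ i i≤n →
          *-integral (fromℕ-integral (suc (suc n) C i))
                     (up-to n (ℕₚ.<-trans (ℕₚ.n<1+n (suc n)) 2+n<p) i (ℕₚ.≤-pred i≤n)))))

  powerSum-≈0 : ∀ {e} → suc e < p → powerSum e p ≈ 0ℚ
  powerSum-≈0 {e} 1+e<p = ≈-trans (fromℕ-*-invertˡ 1+e<p (fromℤ-integral (+ 0)) (begin
    fromℕ (suc e) * powerSum e p                              ≡⟨ faulhaber e p ⟩
    sumℚ (suc e) (λ k → c k * fromℕ p ^ (suc e ∸ k))          ≈⟨ sum-cong-≈ (suc e) term≈0 ⟩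
    sumℚ (suc e) (λ _ → 0ℚ)                                   ≡⟨ sum-zero (suc e) ⟩
    0ℚ                                                        ∎))
    (≈-reflexive (ℚ.*-zeroʳ (1/suc e)))
    where
    open ≈-Reasoning
    c : ℕ → ℚ
    c k = fromℕ (suc e C k) * bernoulli k
    term≈0 : ∀ k → k < suc e → c k * fromℕ p ^ (suc e ∸ k) ≈ 0ℚ
    term≈0 k k<1+e = begin
      c k * fromℕ p ^ (suc e ∸ k)               ≡⟨ cong (λ d → c k * fromℕ p ^ d) (ℕₚ.+-∸-assoc 1 (ℕₚ.≤-pred k<1+e)) ⟩
      c k * (fromℕ p * fromℕ p ^ (e ∸ k))       ≈⟨ *-congˡ integral-c (fromℤ-integral (+ 0))
                                                     (p*≈0 (^-integral (e ∸ k) (fromℕ-integral p))) ⟩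
      c k * 0ℚ                                  ≡⟨ ℚ.*-zeroʳ (c k) ⟩
      0ℚ                                        ∎
      where
      integral-c : Integral (c k)
      integral-c = *-integral (fromℕ-integral (suc e C k))
                              (bernoulli-integral (ℕₚ.≤-<-trans k<1+e 1+e<p))

  p′≈-1 : fromℕ p′ ≈ - 1ℚ
  p′≈-1 = begin
    fromℕ p′              ≡⟨ shift (fromℕ p′) ⟩
    1ℚ + fromℕ p′ + - 1ℚ  ≡⟨ cong (_+ - 1ℚ) (fromℕ-suc p′) ⟨
    fromℕ p + - 1ℚ        ≈⟨ +-cong p≈0 (≈-refl { - 1ℚ}) ⟩
    0ℚ + - 1ℚ             ≡⟨ ℚ.+-identityˡ (- 1ℚ) ⟩
    - 1ℚ                  ∎
    where
    open ≈-Reasoning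
    shift : ∀ x → x ≡ 1ℚ + x + - 1ℚ
    shift = solve-∀ ℚ-ring

  powerSum-p′ : powerSum p′ p ≈ - 1ℚ
  powerSum-p′ = begin
    powerSum p′ p                                   ≡⟨ sum-head p′ (λ i → fromℕ i ^ p′) ⟩
    0ℚ ^ p′ + sumℚ p′ (λ i → fromℕ (suc i) ^ p′)    ≈⟨ +-cong (≈-reflexive (0^-zero 0<p′))
                                                              (sum-cong-≈ p′ λ i i<p′ → fermat-unit (s≤s i<p′)) ⟩
    0ℚ + sumℚ p′ (λ _ → 1ℚ)                         ≡⟨ trans (ℚ.+-identityˡ _) (sum-one p′) ⟩
    fromℕ p′                                        ≈⟨ p′≈-1 ⟩
    - 1ℚ                                            ∎
    where
    open ≈-Reasoning
    0<p′ : 0 < p′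
    0<p′ = ℕₚ.≤-pred (nonTrivial⇒n>1 p {{prime⇒nonTrivial p-prime}})

  fermat-^ : ∀ n e → fromℕ n ^ (p′ ℕ.+ suc e) ≈ fromℕ n ^ suc e
  fermat-^ n e = begin
    fromℕ n ^ (p′ ℕ.+ suc e)        ≡⟨ cong (fromℕ n ^_) (ℕₚ.+-suc p′ e) ⟩
    fromℕ n ^ (p ℕ.+ e)             ≡⟨ ^-homo-* (fromℕ n) p e ⟩
    fromℕ n ^ p * fromℕ n ^ e       ≈⟨ *-cong (^-integral p (fromℕ-integral n)) (^-integral e (fromℕ-integral n))
                                              (fermat n) (≈-refl {fromℕ n ^ e}) ⟩
    fromℕ n * fromℕ n ^ e           ∎
    where open ≈-Reasoning

  powerSum-fermat : ∀ e → powerSum (p′ ℕ.+ suc e) p ≈ powerSum (suc e) p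
  powerSum-fermat e = sum-cong-≈ p (λ n _ → fermat-^ n e)

-- p = k + 4, m = p - 3, M = p - 2
module LhsModulo (k : ℕ) (p-prime : Prime (4 ℕ.+ k)) where

  open Modulo (3 ℕ.+ k) p-prime

  m : ℕ
  m = suc k

  M : ℕ
  M = suc m

  1/suc≈^M : ∀ {i} → suc i < p → 1/suc i ≈ fromℕ (suc i) ^ M
  1/suc≈^M {i} 1+i<p = begin
    1/suc i                          ≡⟨ ℚ.*-identityʳ (1/suc i) ⟨
    1/suc i * 1ℚ                     ≈⟨ *-congˡ (1/suc-integral 1+i<p) (^-integral (suc M) (fromℕ-integral (suc i))) (≈-sym (fermat-unit 1+i<p)) ⟩
    1/suc i * (x * x ^ M)            ≡⟨ ℚ.*-assoc (1/suc i) x (x ^ M) ⟨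
    1/suc i * x * x ^ M              ≡⟨ cong (_* x ^ M) (1/suc-inverseˡ i) ⟩
    1ℚ * x ^ M                       ≡⟨ ℚ.*-identityˡ (x ^ M) ⟩
    x ^ M                            ∎
    where
    open ≈-Reasoning
    x : ℚ
    x = fromℕ (suc i)

  1/suc²≈^m : ∀ {i} → suc i < p → 1/suc i * 1/suc i ≈ fromℕ (suc i) ^ m
  1/suc²≈^m {i} 1+i<p = begin
    u * u                            ≡⟨ ℚ.*-identityʳ (u * u) ⟨
    u * u * 1ℚ                       ≈⟨ *-congˡ (*-integral integral-u integral-u) (^-integral (suc M) (fromℕ-integral (suc i))) (≈-sym (fermat-unit 1+i<p)) ⟩
    u * u * (x * (x * x ^ m))        ≡⟨ regroup u x (x ^ m) ⟩
    u * x * (u * x) * x ^ m          ≡⟨ cong (λ a → a * a * x ^ m) (1/suc-inverseˡ i) ⟩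
    1ℚ * 1ℚ * x ^ m                  ≡⟨ ℚ.*-identityˡ (x ^ m) ⟩
    x ^ m                            ∎
    where
    open ≈-Reasoning
    u x : ℚ
    u = 1/suc i
    x = fromℕ (suc i)
    integral-u : Integral u
    integral-u = 1/suc-integral 1+i<p
    regroup : ∀ u x y → u * u * (x * (x * y)) ≡ u * x * (u * x) * y
    regroup = solve-∀ ℚ-ring

  M<p : M < p
  M<p = ℕₚ.m<n⇒m<1+n (ℕₚ.n<1+n M)

  c : ℕ → ℚ
  c j = fromℕ (M C j) * bernoulli j

  c-integral : ∀ {j} → j ≤ m → Integral (c j)
  c-integral {j} j≤m = *-integral (fromℕ-integral (M C j)) (bernoulli-integral (s≤s (s≤s (ℕₚ.≤-trans j≤m (ℕₚ.n≤1+n m)))))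

  sum-powerSum≈0 : sumℚ p (λ J → powerSum m J) ≈ 0ℚ
  sum-powerSum≈0 = ≈-trans (fromℕ-*-invertˡ M<p (fromℤ-integral (+ 0)) (begin
    fromℕ M * sumℚ p (λ J → powerSum m J)                    ≡⟨ cong (fromℕ M *_) (sum-cong p λ J _ → sym (ℚ.*-identityʳ (powerSum m J))) ⟩
    fromℕ M * sumℚ p (λ J → powerSum m J * fromℕ J ^ 0)      ≡⟨ faulhaber-sum m 0 p ⟩
    sumℚ M (λ j → c j * powerSum (M ∸ j) p)                  ≈⟨ sum-cong-≈ M term≈0 ⟩
    sumℚ M (λ _ → 0ℚ)                                        ≡⟨ sum-zero M ⟩
    0ℚ                                                       ∎))
    (≈-reflexive (ℚ.*-zeroʳ (1/suc m)))
    where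
    open ≈-Reasoning
    term≈0 : ∀ j → j < M → c j * powerSum (M ∸ j) p ≈ 0ℚ
    term≈0 j j<M = ≈-trans (*-congˡ (c-integral (ℕₚ.≤-pred j<M)) (fromℤ-integral (+ 0))
                                    (powerSum-≈0 (s≤s (s≤s (ℕₚ.m∸n≤m M j)))))
                           (≈-reflexive (ℚ.*-zeroʳ (c j)))

  sum-powerSum-*-^M≈-B : sumℚ p (λ J → powerSum m J * fromℕ J ^ M) ≈ - bernoulli m
  sum-powerSum-*-^M≈-B = ≈-trans (fromℕ-*-invertˡ M<p (neg-integral (*-integral (fromℕ-integral M) (bernoulli-integral M<p)))
    (begin
      fromℕ M * sumℚ p (λ J → powerSum m J * fromℕ J ^ M)          ≡⟨ faulhaber-sum m M p ⟩
      sumℚ m (λ j → c j * powerSum (M ℕ.+ (M ∸ j)) p) + c m * powerSum (M ℕ.+ (M ∸ m)) p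
                                                                   ≡⟨ cong (λ e → sumℚ m (λ j → c j * powerSum (M ℕ.+ (M ∸ j)) p) + c m * powerSum e p) M+[M∸m]≡1+M ⟩
      sumℚ m (λ j → c j * powerSum (M ℕ.+ (M ∸ j)) p) + c m * powerSum (suc M) p
                                                                   ≈⟨ +-cong (sum-cong-≈ m lower≈0) (*-congˡ (c-integral ℕₚ.≤-refl) (fromℤ-integral (ℤ.- + 1)) powerSum-p′) ⟩
      sumℚ m (λ _ → 0ℚ) + c m * - 1ℚ                               ≡⟨ cong₂ (λ s d → s + fromℕ d * bernoulli m * - 1ℚ) (sum-zero m) ([1+n]C[n]≡1+n m) ⟩
      0ℚ + fromℕ M * bernoulli m * - 1ℚ                            ≡⟨ simplify (fromℕ M) (bernoulli m) ⟩
      - (fromℕ M * bernoulli m)                                    ∎))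
    (begin
      1/suc m * - (fromℕ M * bernoulli m)       ≡⟨ regroup (1/suc m) (fromℕ M) (bernoulli m) ⟩
      - (1/suc m * fromℕ M * bernoulli m)       ≡⟨ cong (λ a → - (a * bernoulli m)) (1/suc-inverseˡ m) ⟩
      - (1ℚ * bernoulli m)                      ≡⟨ cong -_ (ℚ.*-identityˡ (bernoulli m)) ⟩
      - bernoulli m                             ∎)
    where
    open ≈-Reasoning
    M+[M∸m]≡1+M : M ℕ.+ (M ∸ m) ≡ suc M
    M+[M∸m]≡1+M = trans (cong (M ℕ.+_) (ℕₚ.m+n∸n≡m 1 m)) (ℕₚ.+-comm M 1)
    -- M + (M - j) = (p - 1) + e with 0 < e < p - 2, so Fermat lowers the exponent to e.
    lower≈0 : ∀ j → j < m → c j * powerSum (M ℕ.+ (M ∸ j)) p ≈ 0ℚ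
    lower≈0 j j<m = begin
      c j * powerSum (M ℕ.+ (M ∸ j)) p                 ≡⟨ cong (λ e → c j * powerSum e p) exponent ⟩
      c j * powerSum (suc M ℕ.+ suc (m ∸ suc j)) p     ≈⟨ *-congˡ (c-integral (ℕₚ.<⇒≤ j<m)) (fromℤ-integral (+ 0))
                                                            (≈-trans (powerSum-fermat (m ∸ suc j))
                                                                     (powerSum-≈0 (s≤s (s≤s (s≤s (ℕₚ.m∸n≤m m (suc j))))))) ⟩
      c j * 0ℚ                                         ≡⟨ ℚ.*-zeroʳ (c j) ⟩
      0ℚ                                               ∎
      where
      exponent : M ℕ.+ (M ∸ j) ≡ suc M ℕ.+ suc (m ∸ suc j)
      exponent = trans (cong (M ℕ.+_) (trans (ℕₚ.+-∸-assoc 1 (ℕₚ.<⇒≤ j<m)) (cong suc (ℕₚ.+-∸-assoc 1 j<m))))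
                       (ℕₚ.+-suc M (suc (m ∸ suc j)))
    simplify : ∀ a b → 0ℚ + a * b * - 1ℚ ≡ - (a * b)
    simplify = solve-∀ ℚ-ring
    regroup : ∀ u a b → u * - (a * b) ≡ - (u * a * b)
    regroup = solve-∀ ℚ-ring

  ½-integral : Integral ½
  ½-integral = 1/suc-integral (s≤s (s≤s (s≤s z≤n)))

  -½-integral : Integral -½
  -½-integral = neg-integral ½-integral

  invSq2-integral : ∀ {i j} → i < j → j < suc M → Integral (invSq2 i j)
  invSq2-integral {i} {j} i<j j<1+M = subst Integral (sym (invSq2≡1/suc⁴ i j))
    (*-integral (*-integral (*-integral integral-uᵢ integral-uᵢ) integral-uⱼ) integral-uⱼ)
    where
    integral-uᵢ : Integral (1/suc i)
    integral-uᵢ = 1/suc-integral (s≤s (ℕₚ.<-trans i<j j<1+M))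
    integral-uⱼ : Integral (1/suc j)
    integral-uⱼ = 1/suc-integral (s≤s j<1+M)

  row : ℕ → ℚ
  row j = sumℚ j (λ i → invSq2 i j)

  weight≈ : ∀ j → j < suc M →
    ½ * (fromℕ p * fromℕ (suc M) - fromℕ j * fromℕ (suc j)) * row j ≈ - (½ * (fromℕ j * fromℕ (suc j))) * row j
  weight≈ j j<1+M = *-cong integral-weight (sum-integral j λ i i<j → invSq2-integral i<j j<1+M) weight≈-½y (≈-refl {row j})
    where
    open ≈-Reasoning
    y : ℚ
    y = fromℕ j * fromℕ (suc j)
    integral-weight : Integral (½ * (fromℕ p * fromℕ (suc M) - y))
    integral-weight = *-integral ½-integral (+-integral (*-integral (fromℕ-integral p) (fromℕ-integral (suc M)))
                                                       (neg-integral (*-integral (fromℕ-integral j) (fromℕ-integral (suc j)))))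
    weight≈-½y : ½ * (fromℕ p * fromℕ (suc M) - y) ≈ - (½ * y)
    weight≈-½y = begin
      ½ * (fromℕ p * fromℕ (suc M) - y)   ≈⟨ *-congˡ ½-integral (+-integral (fromℤ-integral (+ 0)) (neg-integral (*-integral (fromℕ-integral j) (fromℕ-integral (suc j)))))
                                               (+-cong (p*≈0 (fromℕ-integral (suc M))) (≈-refl { - y})) ⟩
      ½ * (0ℚ - y)                         ≡⟨ simplify ½ y ⟩
      - (½ * y)                            ∎
      where
      simplify : ∀ h y → h * (0ℚ - y) ≡ - (h * y)
      simplify = solve-∀ ℚ-ring

  row-identity : ∀ j → - (½ * (fromℕ j * fromℕ (suc j))) * row j ≡
                       -½ * sumℚ j (λ i → 1/suc i * 1/suc i - 1/suc i * 1/suc i * 1/suc j)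
  row-identity j = begin
    - (½ * y) * row j                                    ≡⟨ regroup ½ y (row j) ⟩
    -½ * (y * row j)                                     ≡⟨ cong (-½ *_) (*-distribˡ-sum j y (λ i → invSq2 i j)) ⟩
    -½ * sumℚ j (λ i → y * invSq2 i j)                   ≡⟨ cong (-½ *_) (sum-cong j λ i _ →
                                                              trans (cong (y *_) (invSq2≡1/suc⁴ i j))
                                                                    (j[j+1]a/[j+1]²≡a-a/[j+1] j (1/suc i * 1/suc i))) ⟩
    -½ * sumℚ j (λ i → 1/suc i * 1/suc i - 1/suc i * 1/suc i * 1/suc j)   ∎
    where
    open ≡-Reasoning
    y : ℚ
    y = fromℕ j * fromℕ (suc j)
    regroup : ∀ h y r → - (h * y) * r ≡ - h * (y * r)
    regroup = solve-∀ ℚ-ring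

  inverses≈powers : ∀ j → j < suc M →
    sumℚ j (λ i → 1/suc i * 1/suc i - 1/suc i * 1/suc i * 1/suc j) ≈
    sumℚ j (λ i → fromℕ (suc i) ^ m - fromℕ (suc i) ^ m * fromℕ (suc j) ^ M)
  inverses≈powers j j<1+M = sum-cong-≈ j λ i i<j → term≈ (s≤s (ℕₚ.<-trans i<j j<1+M))
    where
    term≈ : ∀ {i} → suc i < p →
      1/suc i * 1/suc i - 1/suc i * 1/suc i * 1/suc j ≈ fromℕ (suc i) ^ m - fromℕ (suc i) ^ m * fromℕ (suc j) ^ M
    term≈ 1+i<p = +-cong (1/suc²≈^m 1+i<p)
      (-‿cong (*-cong (*-integral (1/suc-integral 1+i<p) (1/suc-integral 1+i<p)) (^-integral M (fromℕ-integral (suc j)))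
                      (1/suc²≈^m 1+i<p) (1/suc≈^M (s≤s j<1+M))))

  lhs≈ : lhs p ≈ -½ * bernoulli m
  lhs≈ = begin
    lhs p
      ≡⟨ sum-*-prefixSum (suc M) row ⟩
    sumℚ (suc M) (λ j → ½ * (fromℕ p * fromℕ (suc M) - fromℕ j * fromℕ (suc j)) * row j)
      ≈⟨ sum-cong-≈ (suc M) weight≈ ⟩
    sumℚ (suc M) (λ j → - (½ * (fromℕ j * fromℕ (suc j))) * row j)
      ≡⟨ sum-cong (suc M) (λ j _ → row-identity j) ⟩
    sumℚ (suc M) (λ j → -½ * sumℚ j (λ i → 1/suc i * 1/suc i - 1/suc i * 1/suc i * 1/suc j))
      ≡⟨ *-distribˡ-sum (suc M) -½ (λ j → sumℚ j (λ i → 1/suc i * 1/suc i - 1/suc i * 1/suc i * 1/suc j)) ⟨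
    -½ * sumℚ (suc M) (λ j → sumℚ j (λ i → 1/suc i * 1/suc i - 1/suc i * 1/suc i * 1/suc j))
      ≈⟨ *-congˡ -½-integral powers-integral (sum-cong-≈ (suc M) inverses≈powers) ⟩
    -½ * sumℚ (suc M) (λ j → sumℚ j (λ i → fromℕ (suc i) ^ m - fromℕ (suc i) ^ m * fromℕ (suc j) ^ M))
      ≡⟨ cong (-½ *_) (sum-powers≡sum-powerSum m M (suc M) (s≤s z≤n)) ⟩
    -½ * sumℚ p (λ J → powerSum m J - powerSum m J * fromℕ J ^ M)
      ≡⟨ cong (-½ *_) (sum-- p (λ J → powerSum m J) (λ J → powerSum m J * fromℕ J ^ M)) ⟩
    -½ * (sumℚ p (λ J → powerSum m J) - sumℚ p (λ J → powerSum m J * fromℕ J ^ M))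
      ≈⟨ *-congˡ -½-integral (+-integral (fromℤ-integral (+ 0)) (neg-integral (neg-integral (bernoulli-integral M<p))))
                 (+-cong sum-powerSum≈0 (-‿cong sum-powerSum-*-^M≈-B)) ⟩
    -½ * (0ℚ - - bernoulli m)
      ≡⟨ cong (-½ *_) (simplify (bernoulli m)) ⟩
    -½ * bernoulli m
      ∎
    where
    open ≈-Reasoning
    powers-integral : Integral (sumℚ (suc M) (λ j → sumℚ j (λ i → fromℕ (suc i) ^ m - fromℕ (suc i) ^ m * fromℕ (suc j) ^ M)))
    powers-integral = sum-integral (suc M) λ j _ → sum-integral j λ i _ →
      +-integral (^-integral m (fromℕ-integral (suc i))) (neg-integral (*-integral (^-integral m (fromℕ-integral (suc i))) (^-integral M (fromℕ-integral (suc j)))))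
    simplify : ∀ b → 0ℚ - - b ≡ b
    simplify = solve-∀ ℚ-ring

lemma3p2 : (p : ℕ) → Prime p → 3 < p →
    lhs p ≡ (-[1+ 0 ] / 2) * bernoulli (p ∸ 3) [modℚ p ]
lemma3p2 (suc (suc (suc (suc k)))) p-prime _ = Modulo.≈⇒≡[modℚ] (3 ℕ.+ k) p-prime (LhsModulo.lhs≈ k p-prime)
lemma3p2 0 _ ()
lemma3p2 1 _ (s≤s ())
lemma3p2 2 _ (s≤s (s≤s ()))
lemma3p2 3 _ (s≤s (s≤s (s≤s ())))
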